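{- Let $\operatorname{rdasc}(\pi)$ and $\operatorname{lrdasc}(\pi)$ be the number of right double ascents and left-right double ascents of $\pi$, respectively, and let $u=\sqrt{(t+3)(t-1)}$. Then $$\sum_{n\ge0}\sum_{\pi\in\mathfrak S_n}t^{\operatorname{rdasc}(\pi)}\frac{x^n}{n!}=\frac{u\cosh(\frac12ux)+(1-t)\sinh(\frac12ux)}{u\cosh(\frac12ux)-(1+t)\sinh(\frac12ux)}$$ and $$\sum_{n\ge0}\sum_{\pi\in\mathfrak S_n}t^{\operatorname{lrdasc}(\pi)}\frac{x^n}{n!}=\frac{u\,e^{ -\frac12(1-t)x}}{u\cosh(\frac12ux)-(1+t)\sinh(\frac12ux)}.$$
   Context: $\mathfrak S_n$ is the set of permutations of $[n]$. For $\pi=\pi_1\cdots\pi_n$: $i$ ($2\le i\le n-1$) is a double ascent if $\pi_{i-1}<\pi_i<\pi_{i+1}$; $i$ is a left double ascent if it is a double ascent or $i=1$ and $\pi_1<\pi_2$; $i$ is a right double ascent if it is a double ascent or $i=n$ and $\pi_{n-1}<\pi_n$; $i$ is a left-right double ascent if it is a left double ascent or a right double ascent, or if $\pi=1$ and $i=1$. Right-hand sides are formal power series in $x$ depending only on $u^2$. -}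

module Defs where

open import Data.Bool using (Bool; true; false; if_then_else_; _∧_; _∨_)
open import Data.Nat as ℕ using (ℕ; zero; suc; _<ᵇ_; _≡ᵇ_; _!)
open import Data.Nat.Properties using (_!≢0)
open import Data.Integer using (+_)
open import Data.List using (List; []; _∷_; length; map; filter; concatMap; applyUpTo; foldr)
open import Data.List.Relation.Unary.Unique.DecPropositional ℕ._≟_ using (unique?)
open import Data.Rational using (ℚ; 0ℚ; 1ℚ; _+_; _*_; _-_; -_; _/_)

-- Permutations of [n], realised as words π₁⋯πₙ with distinct letters
-- from {0,…,n-1} (order-isomorphic to [n]; only relative order matters).

words : ℕ → ℕ → List (List ℕ)
words n zero    = [] ∷ []
words n (suc k) = concatMap (λ w → map (λ a → a ∷ w) (applyUpTo (λ i → i) n)) (words n k)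

perms : ℕ → List (List ℕ)
perms n = filter unique? (words n n)

-- 1-indexed access πᵢ (junk value 0 outside 1..n, never used)
at : List ℕ → ℕ → ℕ
at []       _             = 0
at (a ∷ w)  zero          = 0
at (a ∷ w)  (suc zero)    = a
at (a ∷ w)  (suc (suc i)) = at w (suc i)

_≤ᵇ_ : ℕ → ℕ → Bool
m ≤ᵇ n = m <ᵇ suc n

isDasc : List ℕ → ℕ → Bool
isDasc π i = (2 ≤ᵇ i) ∧ (suc i ≤ᵇ length π)
           ∧ (at π (i ℕ.∸ 1) <ᵇ at π i) ∧ (at π i <ᵇ at π (suc i))

isLdasc : List ℕ → ℕ → Bool
isLdasc π i = isDasc π i ∨ ((i ≡ᵇ 1) ∧ (2 ≤ᵇ length π) ∧ (at π 1 <ᵇ at π 2))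

isRdasc : List ℕ → ℕ → Bool
isRdasc π i = isDasc π i ∨ ((i ≡ᵇ length π) ∧ (2 ≤ᵇ length π)
                            ∧ (at π (i ℕ.∸ 1) <ᵇ at π i))

isLrdasc : List ℕ → ℕ → Bool
isLrdasc π i = isLdasc π i ∨ isRdasc π i ∨ ((length π ≡ᵇ 1) ∧ (i ≡ᵇ 1))

countPos : (List ℕ → ℕ → Bool) → List ℕ → ℕ
countPos P π = foldr ℕ._+_ 0
  (applyUpTo (λ j → if P π (suc j) then 1 else 0) (length π))

rdasc : List ℕ → ℕ
rdasc = countPos isRdasc

lrdasc : List ℕ → ℕ
lrdasc = countPos isLrdasc

_^ℚ_ : ℚ → ℕ → ℚ
q ^ℚ zero  = 1ℚ
q ^ℚ suc n = q * (q ^ℚ n)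

sumℚ : List ℚ → ℚ
sumℚ = foldr _+_ 0ℚ

Series : Set
Series = ℕ → ℚ

_⊛_ : Series → Series → Series
(f ⊛ g) n = sumℚ (applyUpTo (λ k → f k * g (n ℕ.∸ k)) (suc n))

inv! : ℕ → ℚ
inv! n = (+ 1) / (n !) where instance _ = n !≢0

egf : (List ℕ → ℕ) → ℚ → Series
egf stat t n = sumℚ (map (λ π → t ^ℚ stat π) (perms n)) * inv! n

u² : ℚ → ℚ
u² t = (t + (+ 3 / 1)) * (t - 1ℚ)

½ : ℚ
½ = + 1 / 2

-- coefficient of xⁿ in cosh(ux/2) times n!:  (u²/4)^{n/2} for n even, 0 for n odd
coshN : ℚ → ℕ → ℚ
coshN t zero          = 1ℚ
coshN t (suc zero)    = 0ℚ
coshN t (suc (suc n)) = (u² t * (+ 1 / 4)) * coshN t n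

-- coefficient of xⁿ in sinh(ux/2)/u times n!:  (u²/4)^k/2 for n = 2k+1, 0 for n even
sinhN : ℚ → ℕ → ℚ
sinhN t zero          = 0ℚ
sinhN t (suc zero)    = ½
sinhN t (suc (suc n)) = (u² t * (+ 1 / 4)) * sinhN t n

coshS : ℚ → Series
coshS t n = coshN t n * inv! n

sinhS/u : ℚ → Series
sinhS/u t n = sinhN t n * inv! n

expS : ℚ → Series
expS t n = (- ((1ℚ - t) * ½)) ^ℚ n * inv! n

-- common denominator divided by u:  cosh(ux/2) - (1+t) sinh(ux/2)/u
den : ℚ → Series
den t n = coshS t n - (1ℚ + t) * sinhS/u t n

-- first numerator divided by u:  cosh(ux/2) + (1-t) sinh(ux/2)/u
num₁ : ℚ → Series
num₁ t n = coshS t n + (1ℚ - t) * sinhS/u t n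

-- second numerator divided by u:  e^{-(1-t)x/2}
num₂ : ℚ → Series
num₂ = expS

-- Split a permutation at its maximal letter m, π = σ m τ. The letter after m is never a double ascent, so
-- rdasc π = rdasc σ + rdasc τ + [σ ≠ ∅ and τ = ∅] and lrdasc π = lrdasc σ + rdasc τ + [τ = ∅]. Summing over the
-- ways to split the remaining letters between σ and τ, the exponential generating functions A of rdasc and B of
-- lrdasc satisfy A′ = A² + (t−1)(A − 1) and B′ = B A + (t−1) B, with A(0) = B(0) = 1. The series
-- D = cosh(ux/2) − (1+t) sinh(ux/2)/u and N₁ = cosh(ux/2) + (1−t) sinh(ux/2)/u satisfy D′ = κ D − N₁ with
-- κ = (1−t)/2, and the two differential equations then force A D = N₁ and B D = e^{−κx}. Everything is
-- verified coefficientwise: products of exponential generating functions become binomial convolutions.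

module Submission where

open import Defs
open import Data.Nat using (ℕ)
open import Data.Rational using (ℚ)
open import Data.Product using (_×_)
open import Relation.Binary.PropositionalEquality using (_≡_)
open import Relation.Binary.Definitions using (DecidableEquality)

module RationalArithmetic where
  open import Data.Nat as ℕ using (zero; suc; _!)
  open import Data.Nat.Properties as ℕ using (_!≢0)
  open import Data.Integer as ℤ using (ℤ; +_)
  import Data.Integer.Properties as ℤ
  open import Data.Rational
  open import Data.Rational.Properties
  import Data.Rational.Unnormalised as ℚᵘ
  import Data.Rational.Unnormalised.Properties as ℚᵘ
  open import Algebra.Bundles using (CommutativeMonoid)
  import Algebra.Properties.CommutativeSemigroup as CommutativeSemigroupProperties
  open import Relation.Binary.PropositionalEquality
  open ≡-Reasoning

  fromℕ : ℕ → ℚ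
  fromℕ n = + n / 1

  toℚᵘ-/-suc : ∀ (i : ℤ) d → toℚᵘ (i / suc d) ℚᵘ.≃ ℚᵘ.mkℚᵘ i d
  toℚᵘ-/-suc i d = toℚᵘ-fromℚᵘ (ℚᵘ.mkℚᵘ i d)

  fromℕ-+ : ∀ m n → fromℕ (m ℕ.+ n) ≡ fromℕ m + fromℕ n
  fromℕ-+ m n = toℚᵘ-injective (ℚᵘ.≃-trans (toℚᵘ-/-suc (+ (m ℕ.+ n)) 0)
    (ℚᵘ.≃-trans (ℚᵘ.*≡* numerators)
      (ℚᵘ.≃-sym (ℚᵘ.≃-trans (toℚᵘ-homo-+ (fromℕ m) (fromℕ n))
                            (ℚᵘ.+-cong (toℚᵘ-/-suc (+ m) 0) (toℚᵘ-/-suc (+ n) 0))))))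
    where
    numerators : + (m ℕ.+ n) ℤ.* + 1 ≡ (+ m ℤ.* + 1 ℤ.+ + n ℤ.* + 1) ℤ.* + 1
    numerators = begin
      + (m ℕ.+ n) ℤ.* + 1             ≡⟨ ℤ.*-identityʳ _ ⟩
      + (m ℕ.+ n)                     ≡⟨ ℤ.pos-+ m n ⟩
      + m ℤ.+ + n                     ≡⟨ cong₂ ℤ._+_ (ℤ.*-identityʳ (+ m)) (ℤ.*-identityʳ (+ n)) ⟨
      + m ℤ.* + 1 ℤ.+ + n ℤ.* + 1     ≡⟨ ℤ.*-identityʳ _ ⟨
      (+ m ℤ.* + 1 ℤ.+ + n ℤ.* + 1) ℤ.* + 1 ∎

  fromℕ-suc-cancelˡ : ∀ n {p q} → fromℕ (suc n) * p ≡ fromℕ (suc n) * q → p ≡ q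
  fromℕ-suc-cancelˡ n {p} {q} eq = begin
    p                 ≡⟨ *-identityˡ p ⟨
    1ℚ * p            ≡⟨ cong (_* p) (*-inverseˡ a) ⟨
    (1/ a * a) * p    ≡⟨ *-assoc (1/ a) a p ⟩
    1/ a * (a * p)    ≡⟨ cong (1/ a *_) eq ⟩
    1/ a * (a * q)    ≡⟨ *-assoc (1/ a) a q ⟨
    (1/ a * a) * q    ≡⟨ cong (_* q) (*-inverseˡ a) ⟩
    1ℚ * q            ≡⟨ *-identityˡ q ⟩
    q                 ∎
    where
    a : ℚ
    a = fromℕ (suc n)
    instance
      a≢0 : NonZero a
      a≢0 = pos⇒nonZero a {{normalize-pos (suc n) 1}}

  fromℕ-*-1/ : ∀ a b → fromℕ (suc a) * (+ 1 / (suc a ℕ.* suc b)) ≡ + 1 / suc b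
  fromℕ-*-1/ a b = toℚᵘ-injective (ℚᵘ.≃-trans (toℚᵘ-homo-* (fromℕ (suc a)) (+ 1 / (suc a ℕ.* suc b)))
    (ℚᵘ.≃-trans (ℚᵘ.*-cong (toℚᵘ-/-suc (+ suc a) 0) (toℚᵘ-/-suc (+ 1) (b ℕ.+ a ℕ.* suc b)))
      (ℚᵘ.≃-trans (ℚᵘ.*≡* crossMultiplied) (ℚᵘ.≃-sym (toℚᵘ-/-suc (+ 1) b)))))
    where
    crossMultiplied : (+ suc a ℤ.* + 1) ℤ.* + suc b ≡ + 1 ℤ.* + (suc a ℕ.* suc b ℕ.+ 0)
    crossMultiplied = begin
      (+ suc a ℤ.* + 1) ℤ.* + suc b   ≡⟨ cong (ℤ._* + suc b) (ℤ.*-identityʳ (+ suc a)) ⟩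
      + suc a ℤ.* + suc b             ≡⟨ ℤ.pos-* (suc a) (suc b) ⟨
      + (suc a ℕ.* suc b)             ≡⟨ cong +_ (ℕ.+-identityʳ _) ⟨
      + (suc a ℕ.* suc b ℕ.+ 0)       ≡⟨ ℤ.*-identityˡ _ ⟨
      + 1 ℤ.* + (suc a ℕ.* suc b ℕ.+ 0) ∎

  fromℕ-*-inv! : ∀ n → fromℕ (suc n) * inv! (suc n) ≡ inv! n
  fromℕ-*-inv! n = go (n !) {{n !≢0}}
    where
    go : ∀ d .{{_ : ℕ.NonZero d}} → fromℕ (suc n) * ((+ 1 / (suc n ℕ.* d)) {{ℕ.m*n≢0 (suc n) d}}) ≡ + 1 / d
    go (suc b) = fromℕ-*-1/ n b

  +-interchange : ∀ a b c d → (a + b) + (c + d) ≡ (a + c) + (b + d)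
  +-interchange = CommutativeSemigroupProperties.interchange (CommutativeMonoid.commutativeSemigroup +-0-commutativeMonoid)

  *-interchange : ∀ a b c d → (a * b) * (c * d) ≡ (a * c) * (b * d)
  *-interchange = CommutativeSemigroupProperties.interchange (CommutativeMonoid.commutativeSemigroup *-1-commutativeMonoid)

  *-leftComm : ∀ a b c → a * (b * c) ≡ b * (a * c)
  *-leftComm = CommutativeSemigroupProperties.x∙yz≈y∙xz (CommutativeMonoid.commutativeSemigroup *-1-commutativeMonoid)

  ^ℚ-homo-* : ∀ q m n → q ^ℚ (m ℕ.+ n) ≡ q ^ℚ m * q ^ℚ n
  ^ℚ-homo-* q zero    n = sym (*-identityˡ _)
  ^ℚ-homo-* q (suc m) n = trans (cong (q *_) (^ℚ-homo-* q m n)) (sym (*-assoc q (q ^ℚ m) (q ^ℚ n)))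

module ListSums where
  open import Data.List using (List; []; _∷_; _++_; map; concatMap)
  open import Data.List.Relation.Unary.All using (All; []; _∷_)
  open import Data.List.Relation.Binary.Permutation.Propositional using (_↭_; ↭⇒↭ₛ)
  import Data.List.Relation.Binary.Permutation.Propositional.Properties as ↭
  open import Data.List.Relation.Binary.Permutation.Setoid.Properties using (foldr-commMonoid)
  open import Data.Rational
  open import Data.Rational.Properties
  open import Function using (_∘_)
  open import Relation.Binary.PropositionalEquality
  open RationalArithmetic using (+-interchange)

  private variable A B : Set

  sumOver : (A → ℚ) → List A → ℚ
  sumOver g xs = sumℚ (map g xs)

  sumOver-++ : ∀ (g : A → ℚ) xs ys → sumOver g (xs ++ ys) ≡ sumOver g xs + sumOver g ys
  sumOver-++ g []       ys = sym (+-identityˡ _)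
  sumOver-++ g (x ∷ xs) ys = trans (cong (g x +_) (sumOver-++ g xs ys)) (sym (+-assoc (g x) _ _))

  sumOver-concatMap : ∀ (g : B → ℚ) (h : A → List B) xs →
                      sumOver g (concatMap h xs) ≡ sumOver (sumOver g ∘ h) xs
  sumOver-concatMap g h []       = refl
  sumOver-concatMap g h (x ∷ xs) =
    trans (sumOver-++ g (h x) (concatMap h xs)) (cong (sumOver g (h x) +_) (sumOver-concatMap g h xs))

  sumOver-map : ∀ (g : B → ℚ) (h : A → B) xs → sumOver g (map h xs) ≡ sumOver (g ∘ h) xs
  sumOver-map g h []       = refl
  sumOver-map g h (x ∷ xs) = cong (g (h x) +_) (sumOver-map g h xs)

  sumOver-cong : ∀ {g g′ : A → ℚ} xs → All (λ x → g x ≡ g′ x) xs → sumOver g xs ≡ sumOver g′ xs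
  sumOver-cong []       []       = refl
  sumOver-cong (x ∷ xs) (e ∷ es) = cong₂ _+_ e (sumOver-cong xs es)

  sumOver-+ : ∀ (g h : A → ℚ) xs → sumOver (λ x → g x + h x) xs ≡ sumOver g xs + sumOver h xs
  sumOver-+ g h []       = refl
  sumOver-+ g h (x ∷ xs) = trans (cong ((g x + h x) +_) (sumOver-+ g h xs))
                                 (+-interchange (g x) (h x) (sumOver g xs) (sumOver h xs))

  sumOver-*ˡ : ∀ k (g : A → ℚ) xs → sumOver (λ x → k * g x) xs ≡ k * sumOver g xs
  sumOver-*ˡ k g []       = sym (*-zeroʳ k)
  sumOver-*ˡ k g (x ∷ xs) = trans (cong (k * g x +_) (sumOver-*ˡ k g xs)) (sym (*-distribˡ-+ k (g x) (sumOver g xs)))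

  sumOver-*ʳ : ∀ k (g : A → ℚ) xs → sumOver (λ x → g x * k) xs ≡ sumOver g xs * k
  sumOver-*ʳ k g []       = sym (*-zeroˡ k)
  sumOver-*ʳ k g (x ∷ xs) = trans (cong (g x * k +_) (sumOver-*ʳ k g xs)) (sym (*-distribʳ-+ k (g x) (sumOver g xs)))

  sumOver-↭ : ∀ (g : A → ℚ) {xs ys} → xs ↭ ys → sumOver g xs ≡ sumOver g ys
  sumOver-↭ g xs↭ys = foldr-commMonoid (setoid ℚ) +-0-isCommutativeMonoid (↭⇒↭ₛ (↭.map⁺ g xs↭ys))

module ListLemmas where
  open import Data.List using (List; []; _∷_; _++_; map; concatMap)
  open import Data.List.Relation.Unary.All as All using (All; []; _∷_)
  import Data.List.Relation.Unary.All.Properties as All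
  import Data.List.Relation.Unary.Any.Properties as Any
  open import Data.List.Relation.Unary.Any using (here; there)
  open import Data.List.Relation.Unary.AllPairs using (AllPairs; []; _∷_)
  open import Data.List.Relation.Unary.Unique.Propositional using (Unique)
  import Data.List.Relation.Unary.Unique.Propositional.Properties as Unique
  open import Data.List.Relation.Binary.Sublist.Propositional using (_⊆_; []; _∷_; _∷ʳ_)
  open import Data.List.Relation.Binary.Sublist.Propositional.Properties using (All-resp-⊆)
  open import Data.List.Properties using (∷-injective; ∷-injectiveʳ)
  open import Data.List.Membership.Propositional using (_∈_; _∉_; find; lose)
  open import Data.List.Relation.Binary.Disjoint.Propositional using (Disjoint)
  open import Data.Product using (∃; _×_; _,_; proj₁)
  open import Data.Empty using (⊥-elim)
  open import Function using (_∘_)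
  open import Relation.Binary.PropositionalEquality

  private variable A B : Set

  All-concatMap⁺ : ∀ {P : A → Set} {Q : B → Set} (h : A → List B) {xs} →
                   All P xs → (∀ {x} → P x → All Q (h x)) → All Q (concatMap h xs)
  All-concatMap⁺ h ps f = All.concat⁺ (All.map⁺ (All.map f ps))

  ∈-concatMap⁺ : ∀ (h : A → List B) {xs x y} → x ∈ xs → y ∈ h x → y ∈ concatMap h xs
  ∈-concatMap⁺ h x∈ y∈ = Any.concatMap⁺ h (lose x∈ y∈)

  ∈-concatMap⁻ : ∀ (h : A → List B) xs {y} → y ∈ concatMap h xs → ∃ λ x → x ∈ xs × y ∈ h x
  ∈-concatMap⁻ h xs y∈ = find (Any.concatMap⁻ h y∈)

  Unique-concatMap⁺ : ∀ (h : A → List B) {xs} → Unique xs → (∀ {x} → x ∈ xs → Unique (h x)) →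
                      (∀ {x x′ y} → x ∈ xs → x′ ∈ xs → y ∈ h x → y ∈ h x′ → x ≡ x′) → Unique (concatMap h xs)
  Unique-concatMap⁺ h {[]}     _            _       _         = []
  Unique-concatMap⁺ h {x ∷ xs} u@(_ ∷ uxs) uniqueₕ injective =
    Unique.++⁺ (uniqueₕ (here refl))
               (Unique-concatMap⁺ h uxs (uniqueₕ ∘ there) (λ x∈ x′∈ → injective (there x∈) (there x′∈)))
               λ (y∈hx , y∈rest) → let (x′ , x′∈ , y∈hx′) = ∈-concatMap⁻ h xs y∈rest in
                 Unique.Unique[x∷xs]⇒x∉xs u (subst (_∈ xs) (sym (injective (here refl) (there x′∈) y∈hx y∈hx′)) x′∈)

  ++-∷-injective : ∀ {m : A} σ σ′ {τ τ′} → m ∉ σ → m ∉ σ′ → σ ++ m ∷ τ ≡ σ′ ++ m ∷ τ′ → σ ≡ σ′ × τ ≡ τ′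
  ++-∷-injective []      []       _   _    eq = refl , ∷-injectiveʳ eq
  ++-∷-injective []      (x ∷ σ′) _   m∉σ′ eq = ⊥-elim (m∉σ′ (here (proj₁ (∷-injective eq))))
  ++-∷-injective (x ∷ σ) []       m∉σ _    eq = ⊥-elim (m∉σ (here (sym (proj₁ (∷-injective eq)))))
  ++-∷-injective (x ∷ σ) (y ∷ σ′) m∉σ m∉σ′ eq with ∷-injective eq
  ... | refl , eq′ with ++-∷-injective σ σ′ (m∉σ ∘ there) (m∉σ′ ∘ there) eq′
  ... | refl , refl = refl , refl

  Unique-++⁻ : ∀ xs {ys : List A} → Unique (xs ++ ys) → Unique xs × Unique ys × Disjoint xs ys
  Unique-++⁻ []       u          = [] , u , λ ()
  Unique-++⁻ (x ∷ xs) (x∉ ∷ u) with uxs , uys , disjoint ← Unique-++⁻ xs u =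
    All.++⁻ˡ xs x∉ ∷ uxs , uys , λ { (here refl , a∈ys) → All.lookup (All.++⁻ʳ xs x∉) a∈ys refl
                                  ; (there a∈xs , a∈ys) → disjoint (a∈xs , a∈ys) }

  concatMap-cong : ∀ {h h′ : A → List B} xs → All (λ x → h x ≡ h′ x) xs → concatMap h xs ≡ concatMap h′ xs
  concatMap-cong []       []       = refl
  concatMap-cong (x ∷ xs) (e ∷ es) = cong₂ _++_ e (concatMap-cong xs es)

  AllPairs-resp-⊆ : ∀ {R : A → A → Set} {xs ys} → xs ⊆ ys → AllPairs R ys → AllPairs R xs
  AllPairs-resp-⊆ []           []         = []
  AllPairs-resp-⊆ (_ ∷ʳ sub)   (_ ∷ rys)  = AllPairs-resp-⊆ sub rys
  AllPairs-resp-⊆ (refl ∷ sub) (ry ∷ rys) = All-resp-⊆ sub ry ∷ AllPairs-resp-⊆ sub rys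

module Convolution where
  open import Data.Nat as ℕ using (zero; suc)
  import Data.Nat.Properties as ℕ
  open import Data.Rational hiding (_≤_)
  open import Data.Rational.Properties
  open import Data.Rational.Solver using (module +-*-Solver)
  open +-*-Solver using (solve; con; _:+_; _:*_; _:=_)
  open import Function using (_∘_)
  open import Relation.Binary.PropositionalEquality
  open ≡-Reasoning
  open RationalArithmetic

  -- Σ_{i+j=n} (n choose i) F i j, computed by Pascal's rule.
  binomialSum : (ℕ → ℕ → ℚ) → ℕ → ℚ
  binomialSum F zero    = F 0 0
  binomialSum F (suc n) = binomialSum (λ i j → F (suc i) j) n + binomialSum (λ i j → F i (suc j)) n

  binomialSum-cong : ∀ n {F G} → (∀ i j → i ℕ.+ j ≡ n → F i j ≡ G i j) → binomialSum F n ≡ binomialSum G n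
  binomialSum-cong zero    eq = eq 0 0 refl
  binomialSum-cong (suc n) eq = cong₂ _+_
    (binomialSum-cong n (λ i j i+j≡n → eq (suc i) j (cong suc i+j≡n)))
    (binomialSum-cong n (λ i j i+j≡n → eq i (suc j) (trans (ℕ.+-suc i j) (cong suc i+j≡n))))

  binomialSum-+ : ∀ n F G → binomialSum (λ i j → F i j + G i j) n ≡ binomialSum F n + binomialSum G n
  binomialSum-+ zero    F G = refl
  binomialSum-+ (suc n) F G = trans (cong₂ _+_ (binomialSum-+ n _ _) (binomialSum-+ n _ _))
    (+-interchange (binomialSum (λ i j → F (suc i) j) n) (binomialSum (λ i j → G (suc i) j) n)
                   (binomialSum (λ i j → F i (suc j)) n) (binomialSum (λ i j → G i (suc j)) n))

  binomialSum-*ˡ : ∀ n k F → binomialSum (λ i j → k * F i j) n ≡ k * binomialSum F n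
  binomialSum-*ˡ zero    k F = refl
  binomialSum-*ˡ (suc n) k F = trans (cong₂ _+_ (binomialSum-*ˡ n k _) (binomialSum-*ˡ n k _))
    (sym (*-distribˡ-+ k (binomialSum (λ i j → F (suc i) j) n) (binomialSum (λ i j → F i (suc j)) n)))

  binomialSum-neg : ∀ n F → binomialSum (λ i j → - F i j) n ≡ - binomialSum F n
  binomialSum-neg zero    F = refl
  binomialSum-neg (suc n) F = trans (cong₂ _+_ (binomialSum-neg n _) (binomialSum-neg n _))
    (sym (neg-distrib-+ (binomialSum (λ i j → F (suc i) j) n) (binomialSum (λ i j → F i (suc j)) n)))

  binomialSum-zero : ∀ n F → (∀ i j → F i j ≡ 0ℚ) → binomialSum F n ≡ 0ℚ
  binomialSum-zero zero    F F≡0 = F≡0 0 0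
  binomialSum-zero (suc n) F F≡0 = cong₂ _+_ (binomialSum-zero n _ (λ i → F≡0 (suc i)))
                                              (binomialSum-zero n _ (λ i j → F≡0 i (suc j)))

  -- If f n and g n are n! times the coefficients of two exponential generating functions, (f ⋆ g) n is that of their product.
  infixl 7 _⋆_
  _⋆_ : Series → Series → Series
  (f ⋆ g) = binomialSum (λ i j → f i * g j)

  δ₀ : Series
  δ₀ zero    = 1ℚ
  δ₀ (suc _) = 0ℚ

  ⋆-identityˡ : ∀ g n → (δ₀ ⋆ g) n ≡ g n
  ⋆-identityˡ g zero    = *-identityˡ (g 0)
  ⋆-identityˡ g (suc n) = trans (cong₂ _+_ (binomialSum-zero n _ (λ _ j → *-zeroˡ (g j))) (⋆-identityˡ (g ∘ suc) n))
                                (+-identityˡ (g (suc n)))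

  ⋆-identityʳ : ∀ f n → (f ⋆ δ₀) n ≡ f n
  ⋆-identityʳ f zero    = *-identityʳ (f 0)
  ⋆-identityʳ f (suc n) = trans (cong₂ _+_ (⋆-identityʳ (f ∘ suc) n) (binomialSum-zero n _ (λ i _ → *-zeroʳ (f i))))
                                (+-identityʳ (f (suc n)))

  ⋆-congˡ : ∀ {f f′} g n → (∀ i → f i ≡ f′ i) → (f ⋆ g) n ≡ (f′ ⋆ g) n
  ⋆-congˡ g n f≗f′ = binomialSum-cong n (λ i j _ → cong (_* g j) (f≗f′ i))

  ⋆-congʳ-≤ : ∀ f {g g′} n → (∀ j → j ℕ.≤ n → g j ≡ g′ j) → (f ⋆ g) n ≡ (f ⋆ g′) n
  ⋆-congʳ-≤ f n g≗g′ = binomialSum-cong n (λ i j i+j≡n → cong (f i *_) (g≗g′ j (subst (j ℕ.≤_) i+j≡n (ℕ.m≤n+m j i))))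

  ⋆-congʳ : ∀ f {g g′} n → (∀ j → g j ≡ g′ j) → (f ⋆ g) n ≡ (f ⋆ g′) n
  ⋆-congʳ f n g≗g′ = ⋆-congʳ-≤ f n (λ j _ → g≗g′ j)

  ⋆-distribʳ-+ : ∀ f g h n → ((λ i → f i + g i) ⋆ h) n ≡ (f ⋆ h) n + (g ⋆ h) n
  ⋆-distribʳ-+ f g h n = trans (binomialSum-cong n (λ i j _ → *-distribʳ-+ (h j) (f i) (g i))) (binomialSum-+ n _ _)

  ⋆-distribˡ-+ : ∀ f g h n → (f ⋆ (λ j → g j + h j)) n ≡ (f ⋆ g) n + (f ⋆ h) n
  ⋆-distribˡ-+ f g h n = trans (binomialSum-cong n (λ i j _ → *-distribˡ-+ (f i) (g j) (h j))) (binomialSum-+ n _ _)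

  ⋆-distribʳ-- : ∀ f g h n → ((λ i → f i - g i) ⋆ h) n ≡ (f ⋆ h) n - (g ⋆ h) n
  ⋆-distribʳ-- f g h n = trans (⋆-distribʳ-+ f (λ i → - g i) h n)
    (cong ((f ⋆ h) n +_) (trans (binomialSum-cong n (λ i j _ → sym (neg-distribˡ-* (g i) (h j)))) (binomialSum-neg n _)))

  ⋆-*ˡ : ∀ k f h n → ((λ i → k * f i) ⋆ h) n ≡ k * (f ⋆ h) n
  ⋆-*ˡ k f h n = trans (binomialSum-cong n (λ i j _ → *-assoc k (f i) (h j))) (binomialSum-*ˡ n k _)

  ⋆-*ʳ : ∀ k f g n → (f ⋆ (λ j → k * g j)) n ≡ k * (f ⋆ g) n
  ⋆-*ʳ k f g n = trans (binomialSum-cong n (λ i j _ → *-leftComm (f i) k (g j))) (binomialSum-*ˡ n k _)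

  ⋆-assoc : ∀ f g h n → ((f ⋆ g) ⋆ h) n ≡ (f ⋆ (g ⋆ h)) n
  ⋆-assoc f g h zero    = *-assoc (f 0) (g 0) (h 0)
  ⋆-assoc f g h (suc n) = begin
    ((λ i → (f ⋆ g) (suc i)) ⋆ h) n + ((f ⋆ g) ⋆ (h ∘ suc)) n
      ≡⟨ cong₂ _+_ (⋆-distribʳ-+ ((f ∘ suc) ⋆ g) (f ⋆ (g ∘ suc)) h n) (⋆-assoc f g (h ∘ suc) n) ⟩
    ((((f ∘ suc) ⋆ g) ⋆ h) n + ((f ⋆ (g ∘ suc)) ⋆ h) n) + (f ⋆ (g ⋆ (h ∘ suc))) n
      ≡⟨ cong (_+ (f ⋆ (g ⋆ (h ∘ suc))) n) (cong₂ _+_ (⋆-assoc (f ∘ suc) g h n) (⋆-assoc f (g ∘ suc) h n)) ⟩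
    (((f ∘ suc) ⋆ (g ⋆ h)) n + (f ⋆ ((g ∘ suc) ⋆ h)) n) + (f ⋆ (g ⋆ (h ∘ suc))) n
      ≡⟨ +-assoc (((f ∘ suc) ⋆ (g ⋆ h)) n) _ _ ⟩
    ((f ∘ suc) ⋆ (g ⋆ h)) n + ((f ⋆ ((g ∘ suc) ⋆ h)) n + (f ⋆ (g ⋆ (h ∘ suc))) n)
      ≡⟨ cong (((f ∘ suc) ⋆ (g ⋆ h)) n +_) (⋆-distribˡ-+ f ((g ∘ suc) ⋆ h) (g ⋆ (h ∘ suc)) n) ⟨
    ((f ∘ suc) ⋆ (g ⋆ h)) n + (f ⋆ (λ j → (g ⋆ h) (suc j))) n ∎

  cauchySum : (ℕ → ℕ → ℚ) → ℕ → ℚ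
  cauchySum F zero    = F 0 0
  cauchySum F (suc n) = F 0 (suc n) + cauchySum (λ i j → F (suc i) j) n

  ⊛-cauchySum : ∀ f g n → (f ⊛ g) n ≡ cauchySum (λ i j → f i * g j) n
  ⊛-cauchySum f g zero    = +-identityʳ (f 0 * g 0)
  ⊛-cauchySum f g (suc n) = cong (f 0 * g (suc n) +_) (⊛-cauchySum (f ∘ suc) g n)

  cauchySum-cong : ∀ n {F G} → (∀ i j → i ℕ.+ j ≡ n → F i j ≡ G i j) → cauchySum F n ≡ cauchySum G n
  cauchySum-cong zero    eq = eq 0 0 refl
  cauchySum-cong (suc n) eq = cong₂ _+_ (eq 0 (suc n) refl)
                                        (cauchySum-cong n (λ i j i+j≡n → eq (suc i) j (cong suc i+j≡n)))

  cauchySum-+ : ∀ n F G → cauchySum (λ i j → F i j + G i j) n ≡ cauchySum F n + cauchySum G n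
  cauchySum-+ zero    F G = refl
  cauchySum-+ (suc n) F G = trans (cong (F 0 (suc n) + G 0 (suc n) +_) (cauchySum-+ n _ _))
    (+-interchange (F 0 (suc n)) (G 0 (suc n)) (cauchySum (λ i j → F (suc i) j) n) (cauchySum (λ i j → G (suc i) j) n))

  cauchySum-*ˡ : ∀ n k F → cauchySum (λ i j → k * F i j) n ≡ k * cauchySum F n
  cauchySum-*ˡ zero    k F = refl
  cauchySum-*ˡ (suc n) k F = trans (cong (k * F 0 (suc n) +_) (cauchySum-*ˡ n k _))
    (sym (*-distribˡ-+ k (F 0 (suc n)) (cauchySum (λ i j → F (suc i) j) n)))

  cauchySum-suc-last : ∀ n F → cauchySum F (suc n) ≡ cauchySum (λ i j → F i (suc j)) n + F (suc n) 0
  cauchySum-suc-last zero    F = refl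
  cauchySum-suc-last (suc n) F = trans (cong (F 0 (suc (suc n)) +_) (cauchySum-suc-last n (λ i j → F (suc i) j)))
    (sym (+-assoc (F 0 (suc (suc n))) (cauchySum (λ i j → F (suc i) (suc j)) n) (F (suc (suc n)) 0)))

  -- (n+1) Σ_{i+j=n+1} H i j splits as Σ i H i j + Σ j H i j; the terms with i = 0 or j = 0 vanish.
  cauchySum-leibniz : ∀ n H → fromℕ (suc n) * cauchySum H (suc n) ≡
    cauchySum (λ i j → fromℕ (suc i) * H (suc i) j) n + cauchySum (λ i j → fromℕ (suc j) * H i (suc j)) n
  cauchySum-leibniz n H = begin
    fromℕ (suc n) * cauchySum H (suc n)
      ≡⟨ cauchySum-*ˡ (suc n) (fromℕ (suc n)) H ⟨
    cauchySum (λ i j → fromℕ (suc n) * H i j) (suc n)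
      ≡⟨ cauchySum-cong (suc n) split ⟩
    cauchySum (λ i j → fromℕ i * H i j + fromℕ j * H i j) (suc n)
      ≡⟨ cauchySum-+ (suc n) (λ i j → fromℕ i * H i j) (λ i j → fromℕ j * H i j) ⟩
    (0ℚ * H 0 (suc n) + X) + cauchySum (λ i j → fromℕ j * H i j) (suc n)
      ≡⟨ cong (0ℚ * H 0 (suc n) + X +_) (cauchySum-suc-last n (λ i j → fromℕ j * H i j)) ⟩
    (0ℚ * H 0 (suc n) + X) + (Y + 0ℚ * H (suc n) 0)
      ≡⟨ drop-zeros (H 0 (suc n)) X Y (H (suc n) 0) ⟩
    X + Y ∎
    where
    X Y : ℚ
    X = cauchySum (λ i j → fromℕ (suc i) * H (suc i) j) n
    Y = cauchySum (λ i j → fromℕ (suc j) * H i (suc j)) n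
    split : ∀ i j → i ℕ.+ j ≡ suc n → fromℕ (suc n) * H i j ≡ fromℕ i * H i j + fromℕ j * H i j
    split i j i+j≡n = trans (cong (λ m → fromℕ m * H i j) (sym i+j≡n))
                            (trans (cong (_* H i j) (fromℕ-+ i j)) (*-distribʳ-+ (H i j) (fromℕ i) (fromℕ j)))
    drop-zeros : ∀ a x y b → (0ℚ * a + x) + (y + 0ℚ * b) ≡ x + y
    drop-zeros = solve 4 (λ a x y b → (con 0ℚ :* a :+ x) :+ (y :+ con 0ℚ :* b) := x :+ y) refl

  -- After multiplication by n+1, Leibniz's rule turns the left-hand side into Pascal's recursion.
  cauchySum-binomialSum : ∀ n F → cauchySum (λ i j → F i j * (inv! i * inv! j)) n ≡ binomialSum F n * inv! n
  cauchySum-binomialSum zero    F = refl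
  cauchySum-binomialSum (suc n) F = fromℕ-suc-cancelˡ n (begin
    fromℕ (suc n) * cauchySum H (suc n)
      ≡⟨ cauchySum-leibniz n H ⟩
    cauchySum (λ i j → fromℕ (suc i) * H (suc i) j) n + cauchySum (λ i j → fromℕ (suc j) * H i (suc j)) n
      ≡⟨ cong₂ _+_ (cauchySum-cong n (λ i j _ → absorbˡ i j)) (cauchySum-cong n (λ i j _ → absorbʳ i j)) ⟩
    cauchySum (λ i j → F (suc i) j * (inv! i * inv! j)) n + cauchySum (λ i j → F i (suc j) * (inv! i * inv! j)) n
      ≡⟨ cong₂ _+_ (cauchySum-binomialSum n (λ i j → F (suc i) j)) (cauchySum-binomialSum n (λ i j → F i (suc j))) ⟩
    P * inv! n + Q * inv! n
      ≡⟨ *-distribʳ-+ (inv! n) P Q ⟨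
    (P + Q) * inv! n
      ≡⟨ cong ((P + Q) *_) (fromℕ-*-inv! n) ⟨
    (P + Q) * (fromℕ (suc n) * inv! (suc n))
      ≡⟨ *-leftComm (P + Q) (fromℕ (suc n)) (inv! (suc n)) ⟩
    fromℕ (suc n) * ((P + Q) * inv! (suc n)) ∎)
    where
    H : ℕ → ℕ → ℚ
    H i j = F i j * (inv! i * inv! j)
    P Q : ℚ
    P = binomialSum (λ i j → F (suc i) j) n
    Q = binomialSum (λ i j → F i (suc j)) n
    absorbˡ : ∀ i j → fromℕ (suc i) * H (suc i) j ≡ F (suc i) j * (inv! i * inv! j)
    absorbˡ i j = trans (solve 4 (λ a f x y → a :* (f :* (x :* y)) := f :* ((a :* x) :* y)) refl
                                 (fromℕ (suc i)) (F (suc i) j) (inv! (suc i)) (inv! j))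
                        (cong (λ z → F (suc i) j * (z * inv! j)) (fromℕ-*-inv! i))
    absorbʳ : ∀ i j → fromℕ (suc j) * H i (suc j) ≡ F i (suc j) * (inv! i * inv! j)
    absorbʳ i j = trans (solve 4 (λ a f x y → a :* (f :* (x :* y)) := f :* (x :* (a :* y))) refl
                                 (fromℕ (suc j)) (F i (suc j)) (inv! i) (inv! (suc j)))
                        (cong (λ z → F i (suc j) * (inv! i * z)) (fromℕ-*-inv! j))

  egfOf : Series → Series
  egfOf a n = a n * inv! n

  ⊛-cong : ∀ {f f′ g g′} → (∀ n → f n ≡ f′ n) → (∀ n → g n ≡ g′ n) → ∀ n → (f ⊛ g) n ≡ (f′ ⊛ g′) n
  ⊛-cong {f} {f′} {g} {g′} f≗f′ g≗g′ n = begin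
    (f ⊛ g) n                           ≡⟨ ⊛-cauchySum f g n ⟩
    cauchySum (λ i j → f i * g j) n     ≡⟨ cauchySum-cong n (λ i j _ → cong₂ _*_ (f≗f′ i) (g≗g′ j)) ⟩
    cauchySum (λ i j → f′ i * g′ j) n   ≡⟨ ⊛-cauchySum f′ g′ n ⟨
    (f′ ⊛ g′) n                         ∎

  egfOf-⋆ : ∀ a b n → (egfOf a ⊛ egfOf b) n ≡ egfOf (a ⋆ b) n
  egfOf-⋆ a b n = begin
    (egfOf a ⊛ egfOf b) n
      ≡⟨ ⊛-cauchySum (egfOf a) (egfOf b) n ⟩
    cauchySum (λ i j → (a i * inv! i) * (b j * inv! j)) n
      ≡⟨ cauchySum-cong n (λ i j _ → *-interchange (a i) (inv! i) (b j) (inv! j)) ⟩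
    cauchySum (λ i j → (a i * b j) * (inv! i * inv! j)) n
      ≡⟨ cauchySum-binomialSum n (λ i j → a i * b j) ⟩
    egfOf (a ⋆ b) n ∎

module HyperbolicSeries (t : ℚ) where
  open import Data.Nat as ℕ using (zero; suc; z≤n; s≤s)
  import Data.Nat.Properties as ℕ
  open import Data.Integer using (+_)
  open import Data.Rational hiding (½)
  open import Data.Rational.Properties
  open import Data.Rational.Solver using (module +-*-Solver)
  open +-*-Solver using (solve; con; _:+_; _:-_; _:*_; :-_; _:=_)
  open import Data.Sum using (inj₁; inj₂)
  open import Function using (_∘_)
  open import Relation.Binary.PropositionalEquality
  open ≡-Reasoning
  open Convolution

  u²/4 : ℚ
  u²/4 = u² t * (+ 1 / 4)

  coshN-suc : ∀ n → coshN t (suc n) ≡ (+ 2 / 1) * u²/4 * sinhN t n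
  coshN-suc zero          = sym (*-zeroʳ ((+ 2 / 1) * u²/4))
  coshN-suc (suc zero)    = solve 1 (λ w → w :* con 1ℚ := con (+ 2 / 1) :* w :* con ½) refl u²/4
  coshN-suc (suc (suc n)) = trans (cong (u²/4 *_) (coshN-suc n))
    (solve 2 (λ w s → w :* (con (+ 2 / 1) :* w :* s) := con (+ 2 / 1) :* w :* (w :* s)) refl u²/4 (sinhN t n))

  sinhN-suc : ∀ n → sinhN t (suc n) ≡ ½ * coshN t n
  sinhN-suc zero          = sym (*-identityʳ ½)
  sinhN-suc (suc zero)    = trans (*-zeroʳ u²/4) (sym (*-zeroʳ ½))
  sinhN-suc (suc (suc n)) = trans (cong (u²/4 *_) (sinhN-suc n))
    (solve 2 (λ w c → w :* (con ½ :* c) := con ½ :* (w :* c)) refl u²/4 (coshN t n))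

  denN num₁N : Series
  denN  n = coshN t n - (1ℚ + t) * sinhN t n
  num₁N n = coshN t n + (1ℚ - t) * sinhN t n

  den≡egfOf-denN : ∀ n → den t n ≡ egfOf denN n
  den≡egfOf-denN n = solve 4 (λ t c s i → c :* i :- (con 1ℚ :+ t) :* (s :* i) := (c :- (con 1ℚ :+ t) :* s) :* i)
                           refl t (coshN t n) (sinhN t n) (inv! n)

  num₁≡egfOf-num₁N : ∀ n → num₁ t n ≡ egfOf num₁N n
  num₁≡egfOf-num₁N n = solve 4 (λ t c s i → c :* i :+ (con 1ℚ :- t) :* (s :* i) := (c :+ (con 1ℚ :- t) :* s) :* i)
                             refl t (coshN t n) (sinhN t n) (inv! n)

  κ : ℚ
  κ = (1ℚ - t) * ½

  -- Coefficientwise form of D′ = κ D − N₁, where D = cosh(ux/2) − (1+t) sinh(ux/2)/u and N₁ = cosh(ux/2) + (1−t) sinh(ux/2)/u.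
  num₁N+denN-suc : ∀ n → num₁N n + denN (suc n) ≡ κ * denN n
  num₁N+denN-suc n = begin
    num₁N n + (coshN t (suc n) - (1ℚ + t) * sinhN t (suc n))
      ≡⟨ cong₂ (λ x y → num₁N n + (x - (1ℚ + t) * y)) (coshN-suc n) (sinhN-suc n) ⟩
    num₁N n + ((+ 2 / 1) * u²/4 * sinhN t n - (1ℚ + t) * (½ * coshN t n))
      ≡⟨ solve 3 (λ t c s →
           (c :+ (con 1ℚ :- t) :* s) :+ (con (+ 2 / 1) :* ((t :+ con (+ 3 / 1)) :* (t :- con 1ℚ) :* con (+ 1 / 4)) :* s
             :- (con 1ℚ :+ t) :* (con ½ :* c))
           := ((con 1ℚ :- t) :* con ½) :* (c :- (con 1ℚ :+ t) :* s)) refl t (coshN t n) (sinhN t n) ⟩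
    κ * denN n ∎

  num₁N-suc : ∀ n → κ * num₁N n + (t - 1ℚ) * (num₁N n - denN n) ≡ num₁N (suc n)
  num₁N-suc n = begin
    κ * num₁N n + (t - 1ℚ) * (num₁N n - denN n)
      ≡⟨ solve 3 (λ t c s →
           ((con 1ℚ :- t) :* con ½) :* (c :+ (con 1ℚ :- t) :* s)
             :+ (t :- con 1ℚ) :* ((c :+ (con 1ℚ :- t) :* s) :- (c :- (con 1ℚ :+ t) :* s))
           := con (+ 2 / 1) :* ((t :+ con (+ 3 / 1)) :* (t :- con 1ℚ) :* con (+ 1 / 4)) :* s
             :+ (con 1ℚ :- t) :* (con ½ :* c)) refl t (coshN t n) (sinhN t n) ⟩
    (+ 2 / 1) * u²/4 * sinhN t n + (1ℚ - t) * (½ * coshN t n)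
      ≡⟨ cong₂ (λ x y → x + (1ℚ - t) * y) (coshN-suc n) (sinhN-suc n) ⟨
    num₁N (suc n) ∎

  -- For A = Σ αₙ xⁿ/n! with A′ = A² + (t−1)(A − 1): (A D)′ = A (A D − N₁) + κ (A D) + (t−1)(A D − D), so if A D
  -- agrees with N₁ up to degree n then (A D)′ agrees with κ N₁ + (t−1)(N₁ − D) = N₁′ in degree n.
  module _ (α : Series) (α₀ : α 0 ≡ 1ℚ)
           (α-suc : ∀ n → α (suc n) ≡ (α ⋆ α) n + (t - 1ℚ) * (α n - δ₀ n)) where

    α⋆denN-suc : ∀ n → (∀ j → j ℕ.≤ n → (α ⋆ denN) j ≡ num₁N j) → (α ⋆ denN) (suc n) ≡ num₁N (suc n)
    α⋆denN-suc n ih = begin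
      ((α ∘ suc) ⋆ denN) n + (α ⋆ (denN ∘ suc)) n
        ≡⟨ cong (_+ (α ⋆ (denN ∘ suc)) n) derivative-of-α ⟩
      ((α ⋆ num₁N) n + (t - 1ℚ) * (num₁N n - denN n)) + (α ⋆ (denN ∘ suc)) n
        ≡⟨ solve 3 (λ x y z → (x :+ y) :+ z := (x :+ z) :+ y) refl ((α ⋆ num₁N) n) _ _ ⟩
      ((α ⋆ num₁N) n + (α ⋆ (denN ∘ suc)) n) + (t - 1ℚ) * (num₁N n - denN n)
        ≡⟨ cong (_+ (t - 1ℚ) * (num₁N n - denN n)) derivative-of-denN ⟩
      κ * num₁N n + (t - 1ℚ) * (num₁N n - denN n)
        ≡⟨ num₁N-suc n ⟩
      num₁N (suc n) ∎
      where
      derivative-of-α : ((α ∘ suc) ⋆ denN) n ≡ (α ⋆ num₁N) n + (t - 1ℚ) * (num₁N n - denN n)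
      derivative-of-α = begin
        ((α ∘ suc) ⋆ denN) n
          ≡⟨ ⋆-congˡ denN n α-suc ⟩
        ((λ i → (α ⋆ α) i + (t - 1ℚ) * (α i - δ₀ i)) ⋆ denN) n
          ≡⟨ ⋆-distribʳ-+ (α ⋆ α) (λ i → (t - 1ℚ) * (α i - δ₀ i)) denN n ⟩
        ((α ⋆ α) ⋆ denN) n + ((λ i → (t - 1ℚ) * (α i - δ₀ i)) ⋆ denN) n
          ≡⟨ cong₂ _+_ (⋆-assoc α α denN n) (trans (⋆-*ˡ (t - 1ℚ) _ denN n) (cong ((t - 1ℚ) *_) (⋆-distribʳ-- α δ₀ denN n))) ⟩
        (α ⋆ (α ⋆ denN)) n + (t - 1ℚ) * ((α ⋆ denN) n - (δ₀ ⋆ denN) n)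
          ≡⟨ cong₂ (λ x y → x + (t - 1ℚ) * (y - (δ₀ ⋆ denN) n)) (⋆-congʳ-≤ α n ih) (ih n ℕ.≤-refl) ⟩
        (α ⋆ num₁N) n + (t - 1ℚ) * (num₁N n - (δ₀ ⋆ denN) n)
          ≡⟨ cong (λ x → (α ⋆ num₁N) n + (t - 1ℚ) * (num₁N n - x)) (⋆-identityˡ denN n) ⟩
        (α ⋆ num₁N) n + (t - 1ℚ) * (num₁N n - denN n) ∎
      derivative-of-denN : (α ⋆ num₁N) n + (α ⋆ (denN ∘ suc)) n ≡ κ * num₁N n
      derivative-of-denN = begin
        (α ⋆ num₁N) n + (α ⋆ (denN ∘ suc)) n   ≡⟨ ⋆-distribˡ-+ α num₁N (denN ∘ suc) n ⟨
        (α ⋆ (λ j → num₁N j + denN (suc j))) n ≡⟨ ⋆-congʳ α n num₁N+denN-suc ⟩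
        (α ⋆ (λ j → κ * denN j)) n             ≡⟨ ⋆-*ʳ κ α denN n ⟩
        κ * (α ⋆ denN) n                       ≡⟨ cong (κ *_) (ih n ℕ.≤-refl) ⟩
        κ * num₁N n                            ∎

    α⋆denN≡num₁N : ∀ n → (α ⋆ denN) n ≡ num₁N n
    α⋆denN≡num₁N n = below n n ℕ.≤-refl
      where
      below : ∀ n j → j ℕ.≤ n → (α ⋆ denN) j ≡ num₁N j
      below zero    zero z≤n = trans (cong (_* denN 0) α₀)
        (solve 1 (λ t → con 1ℚ :* (con 1ℚ :- (con 1ℚ :+ t) :* con 0ℚ) := con 1ℚ :+ (con 1ℚ :- t) :* con 0ℚ) refl t)
      below (suc n) j j≤1+n with ℕ.m≤n⇒m<n∨m≡n j≤1+n
      ... | inj₁ (s≤s j≤n) = below n j j≤n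
      ... | inj₂ refl      = α⋆denN-suc n (below n)

    -- For B = Σ βₙ xⁿ/n! with B′ = B A + (t−1) B: (B D)′ = B (A D − N₁) + κ (B D) + (t−1)(B D) = −κ (B D).
    module _ (β : Series) (β₀ : β 0 ≡ 1ℚ) (β-suc : ∀ n → β (suc n) ≡ (β ⋆ α) n + (t - 1ℚ) * β n) where

      β⋆denN≡exp : ∀ n → (β ⋆ denN) n ≡ (- κ) ^ℚ n
      β⋆denN≡exp zero = trans (cong (_* denN 0) β₀)
        (solve 1 (λ t → con 1ℚ :* (con 1ℚ :- (con 1ℚ :+ t) :* con 0ℚ) := con 1ℚ) refl t)
      β⋆denN≡exp (suc n) = begin
        ((β ∘ suc) ⋆ denN) n + (β ⋆ (denN ∘ suc)) n
          ≡⟨ cong (_+ (β ⋆ (denN ∘ suc)) n) (⋆-congˡ denN n β-suc) ⟩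
        ((λ i → (β ⋆ α) i + (t - 1ℚ) * β i) ⋆ denN) n + (β ⋆ (denN ∘ suc)) n
          ≡⟨ cong (_+ (β ⋆ (denN ∘ suc)) n) (⋆-distribʳ-+ (β ⋆ α) (λ i → (t - 1ℚ) * β i) denN n) ⟩
        (((β ⋆ α) ⋆ denN) n + ((λ i → (t - 1ℚ) * β i) ⋆ denN) n) + (β ⋆ (denN ∘ suc)) n
          ≡⟨ cong (_+ (β ⋆ (denN ∘ suc)) n) (cong₂ _+_ (trans (⋆-assoc β α denN n) (⋆-congʳ β n α⋆denN≡num₁N))
                                                        (⋆-*ˡ (t - 1ℚ) β denN n)) ⟩
        ((β ⋆ num₁N) n + (t - 1ℚ) * (β ⋆ denN) n) + (β ⋆ (denN ∘ suc)) n
          ≡⟨ solve 3 (λ x y z → (x :+ y) :+ z := (x :+ z) :+ y) refl ((β ⋆ num₁N) n) _ _ ⟩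
        ((β ⋆ num₁N) n + (β ⋆ (denN ∘ suc)) n) + (t - 1ℚ) * (β ⋆ denN) n
          ≡⟨ cong (_+ (t - 1ℚ) * (β ⋆ denN) n) (trans (sym (⋆-distribˡ-+ β num₁N (denN ∘ suc) n))
                                                      (trans (⋆-congʳ β n num₁N+denN-suc) (⋆-*ʳ κ β denN n))) ⟩
        κ * (β ⋆ denN) n + (t - 1ℚ) * (β ⋆ denN) n
          ≡⟨ cong (λ x → κ * x + (t - 1ℚ) * x) (β⋆denN≡exp n) ⟩
        κ * (- κ) ^ℚ n + (t - 1ℚ) * (- κ) ^ℚ n
          ≡⟨ solve 2 (λ t x → ((con 1ℚ :- t) :* con ½) :* x :+ (t :- con 1ℚ) :* x
                              := (:- ((con 1ℚ :- t) :* con ½)) :* x) refl t ((- κ) ^ℚ n) ⟩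
        (- κ) ^ℚ (suc n) ∎

module Statistics where
  open import Data.Bool using (Bool; true; false; if_then_else_; _∧_; _∨_; T)
  open import Data.Bool.Properties using (∨-identityʳ; ∧-identityʳ; ∧-zeroʳ)
  open import Data.Nat as ℕ using (zero; suc; _<ᵇ_; _≡ᵇ_; _<_; _+_)
  open import Data.Nat.Properties using (+-identityʳ; +-assoc; <-asym; <ᵇ⇒<; <⇒<ᵇ)
  open import Data.List using (List; []; _∷_; length; _++_; foldr; applyUpTo)
  open import Data.List.Relation.Unary.All using (All; []; _∷_)
  open import Data.Empty using (⊥-elim)
  open import Relation.Binary.PropositionalEquality

  ⟦_⟧ : Bool → ℕ
  ⟦ b ⟧ = if b then 1 else 0

  -- rdascAfter p w counts the right double ascents of p ∷ w at the positions of w.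
  rdascAfter : ℕ → List ℕ → ℕ
  rdascAfter p []          = 0
  rdascAfter p (x ∷ [])    = ⟦ p <ᵇ x ⟧
  rdascAfter p (x ∷ y ∷ w) = ⟦ (p <ᵇ x) ∧ (x <ᵇ y) ⟧ + rdascAfter x (y ∷ w)

  rdasc′ : List ℕ → ℕ
  rdasc′ []      = 0
  rdasc′ (x ∷ w) = rdascAfter x w

  lrdascHead : ℕ → List ℕ → ℕ
  lrdascHead x []      = 1
  lrdascHead x (y ∷ _) = ⟦ x <ᵇ y ⟧

  lrdasc′ : List ℕ → ℕ
  lrdasc′ []      = 0
  lrdasc′ (x ∷ w) = lrdascHead x w + rdascAfter x w

  countAfterHead : (List ℕ → ℕ → Bool) → ℕ → List ℕ → ℕ
  countAfterHead P p w = foldr _+_ 0 (applyUpTo (λ j → ⟦ P (p ∷ w) (suc (suc j)) ⟧) (length w))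

  countAfterHead-isRdasc : ∀ p w → countAfterHead isRdasc p w ≡ rdascAfter p w
  countAfterHead-isRdasc p []          = refl
  countAfterHead-isRdasc p (x ∷ [])    = +-identityʳ _
  countAfterHead-isRdasc p (x ∷ y ∷ w) =
    cong₂ _+_ (cong ⟦_⟧ (∨-identityʳ ((p <ᵇ x) ∧ (x <ᵇ y)))) (countAfterHead-isRdasc x (y ∷ w))

  rdasc≡rdasc′ : ∀ π → rdasc π ≡ rdasc′ π
  rdasc≡rdasc′ []          = refl
  rdasc≡rdasc′ (p ∷ [])    = refl
  rdasc≡rdasc′ (p ∷ x ∷ w) = countAfterHead-isRdasc p (x ∷ w)

  isLrdasc≡isRdasc : ∀ π j → isLrdasc π (suc (suc j)) ≡ isRdasc π (suc (suc j))
  isLrdasc≡isRdasc π j = absorb (isDasc π (suc (suc j))) _ (length π ≡ᵇ 1)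
    where
    absorb : ∀ d r l → (d ∨ false) ∨ ((d ∨ r) ∨ (l ∧ false)) ≡ d ∨ r
    absorb false false false = refl
    absorb false false true  = refl
    absorb false true  l     = refl
    absorb true  r     l     = refl

  sum-applyUpTo-cong : ∀ n {f g} → (∀ j → f j ≡ g j) → foldr _+_ 0 (applyUpTo f n) ≡ foldr _+_ 0 (applyUpTo g n)
  sum-applyUpTo-cong zero    f≗g = refl
  sum-applyUpTo-cong (suc n) f≗g = cong₂ _+_ (f≗g 0) (sum-applyUpTo-cong n (λ j → f≗g (suc j)))

  lrdasc≡lrdasc′ : ∀ π → lrdasc π ≡ lrdasc′ π
  lrdasc≡lrdasc′ []          = refl
  lrdasc≡lrdasc′ (p ∷ [])    = refl
  lrdasc≡lrdasc′ (p ∷ x ∷ w) = cong₂ _+_ (cong ⟦_⟧ (∨-identityʳ (p <ᵇ x)))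
    (trans (sum-applyUpTo-cong (suc (length w)) (λ j → cong ⟦_⟧ (isLrdasc≡isRdasc (p ∷ x ∷ w) j)))
           (countAfterHead-isRdasc p (x ∷ w)))

  <ᵇ-false : ∀ {x m} → x < m → (m <ᵇ x) ≡ false
  <ᵇ-false {x} {m} x<m with m <ᵇ x in eq
  ... | false = refl
  ... | true  = ⊥-elim (<-asym x<m (<ᵇ⇒< m x (subst T (sym eq) _)))

  <ᵇ-true : ∀ {p m} → p < m → (p <ᵇ m) ≡ true
  <ᵇ-true {p} {m} p<m with p <ᵇ m | <⇒<ᵇ p<m
  ... | true | _ = refl

  -- Contribution of the maximal letter m of σ ++ m ∷ τ, in terms of length σ and length τ: it is a right
  -- double ascent iff it is last and not first, a left-right double ascent iff it is last.
  rdascAtMax : ℕ → ℕ → ℕ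
  rdascAtMax zero    _       = 0
  rdascAtMax (suc _) zero    = 1
  rdascAtMax (suc _) (suc _) = 0

  lrdascAtMax : ℕ → ℕ
  lrdascAtMax zero    = 1
  lrdascAtMax (suc _) = 0

  rdascAfter-max : ∀ m τ → All (_< m) τ → rdascAfter m τ ≡ rdasc′ τ
  rdascAfter-max m []          _          = refl
  rdascAfter-max m (x ∷ [])    (x<m ∷ []) rewrite <ᵇ-false x<m = refl
  rdascAfter-max m (x ∷ y ∷ τ) (x<m ∷ _)  rewrite <ᵇ-false x<m = refl

  rdascAfter-++-max : ∀ p σ m τ → p < m → All (_< m) σ → All (_< m) τ →
                      rdascAfter p (σ ++ m ∷ τ) ≡ rdascAfter p σ + (rdasc′ τ + lrdascAtMax (length τ))
  rdascAfter-++-max p []          m []      p<m _ _ rewrite <ᵇ-true p<m = refl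
  rdascAfter-++-max p []          m (y ∷ τ) p<m _ (y<m ∷ τ<m) =
    cong₂ _+_ (cong ⟦_⟧ (trans (cong ((p <ᵇ m) ∧_) (<ᵇ-false y<m)) (∧-zeroʳ _)))
              (trans (rdascAfter-max m (y ∷ τ) (y<m ∷ τ<m)) (sym (+-identityʳ _)))
  rdascAfter-++-max p (x ∷ [])    m τ p<m (x<m ∷ []) τ<m rewrite <ᵇ-true x<m | ∧-identityʳ (p <ᵇ x) =
    cong (⟦ p <ᵇ x ⟧ +_) (rdascAfter-++-max x [] m τ x<m [] τ<m)
  rdascAfter-++-max p (x ∷ y ∷ σ) m τ p<m (x<m ∷ σ<m) τ<m =
    trans (cong (⟦ (p <ᵇ x) ∧ (x <ᵇ y) ⟧ +_) (rdascAfter-++-max x (y ∷ σ) m τ x<m σ<m τ<m))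
          (sym (+-assoc ⟦ (p <ᵇ x) ∧ (x <ᵇ y) ⟧ (rdascAfter x (y ∷ σ)) _))

  -- The letter after the maximum is never a double ascent, so τ contributes exactly rdasc′ τ.
  rdasc′-++-max : ∀ σ m τ → All (_< m) σ → All (_< m) τ →
                  rdasc′ (σ ++ m ∷ τ) ≡ rdasc′ σ + (rdasc′ τ + rdascAtMax (length σ) (length τ))
  rdasc′-++-max []      m τ       _          τ<m = trans (rdascAfter-max m τ τ<m) (sym (+-identityʳ _))
  rdasc′-++-max (x ∷ σ) m []      (x<m ∷ σ<m) τ<m = rdascAfter-++-max x σ m [] x<m σ<m τ<m
  rdasc′-++-max (x ∷ σ) m (y ∷ τ) (x<m ∷ σ<m) τ<m = rdascAfter-++-max x σ m (y ∷ τ) x<m σ<m τ<m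

  lrdascHead-++-max : ∀ x σ m τ → x < m → lrdascHead x (σ ++ m ∷ τ) ≡ lrdascHead x σ
  lrdascHead-++-max x []      m τ x<m rewrite <ᵇ-true x<m = refl
  lrdascHead-++-max x (y ∷ σ) m τ x<m = refl

  lrdasc′-++-max : ∀ σ m τ → All (_< m) σ → All (_< m) τ →
                   lrdasc′ (σ ++ m ∷ τ) ≡ lrdasc′ σ + (rdasc′ τ + lrdascAtMax (length τ))
  lrdasc′-++-max []      m []      _ _ = refl
  lrdasc′-++-max []      m (y ∷ τ) _ (y<m ∷ τ<m) rewrite <ᵇ-false y<m =
    trans (rdascAfter-max m (y ∷ τ) (y<m ∷ τ<m)) (sym (+-identityʳ _))
  lrdasc′-++-max (x ∷ σ) m τ (x<m ∷ σ<m) τ<m =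
    trans (cong₂ _+_ (lrdascHead-++-max x σ m τ x<m) (rdascAfter-++-max x σ m τ x<m σ<m τ<m))
          (sym (+-assoc (lrdascHead x σ) (rdascAfter x σ) _))

module Splits {A : Set} (_≟_ : DecidableEquality A) where
  open import Data.Nat as ℕ using (suc)
  import Data.Nat.Properties as ℕ
  open import Data.List using (List; []; _∷_; length; concatMap)
  open import Data.List.Relation.Unary.All as All using (All; []; _∷_)
  open import Data.List.Relation.Unary.Any using (here; there)
  open import Data.List.Relation.Unary.AllPairs using (AllPairs; []; _∷_)
  open import Data.List.Relation.Unary.Unique.Propositional using (Unique)
  open import Data.List.Relation.Unary.Unique.Propositional.Properties using (Unique[x∷xs]⇒x∉xs)
  open import Data.List.Relation.Binary.Sublist.Propositional using (_⊆_; []; _∷_; _∷ʳ_; lookup)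
  open import Data.List.Relation.Binary.Sublist.Propositional.Properties using (length-mono-≤)
  open import Data.List.Relation.Binary.Disjoint.Propositional using (Disjoint)
  open import Data.List.Membership.Propositional using (_∈_; _∉_)
  open import Data.List.Membership.DecPropositional _≟_ using (_∈?_)
  open import Data.Product using (_×_; _,_; proj₁; proj₂)
  open import Data.Sum using (_⊎_; inj₁; inj₂)
  open import Data.Empty using (⊥-elim)
  open import Data.Rational using (ℚ; _+_)
  open import Data.Rational.Properties using (+-identityʳ)
  open import Relation.Nullary using (yes; no)
  open import Function using (_∘_)
  open import Relation.Binary.PropositionalEquality
  open ≡-Reasoning
  open ListLemmas
  open ListSums using (sumOver; sumOver-concatMap; sumOver-cong; sumOver-+)
  open Convolution using (binomialSum)

  Split : Set
  Split = List A × List A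

  putEither : A → Split → List Split
  putEither x (ys , zs) = (x ∷ ys , zs) ∷ (ys , x ∷ zs) ∷ []

  splits : List A → List Split
  splits []       = ([] , []) ∷ []
  splits (x ∷ xs) = concatMap (putEither x) (splits xs)

  record IsSplit (xs : List A) (yz : Split) : Set where
    field
      left⊆    : proj₁ yz ⊆ xs
      right⊆   : proj₂ yz ⊆ xs
      length-+ : length (proj₁ yz) ℕ.+ length (proj₂ yz) ≡ length xs
      covers   : ∀ {a} → a ∈ xs → a ∈ proj₁ yz ⊎ a ∈ proj₂ yz
      disjoint : Unique xs → Disjoint (proj₁ yz) (proj₂ yz)

    left-≤ : ∀ {n} → length xs ℕ.≤ n → length (proj₁ yz) ℕ.≤ n
    left-≤ = ℕ.≤-trans (length-mono-≤ left⊆)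

    right-≤ : ∀ {n} → length xs ℕ.≤ n → length (proj₂ yz) ℕ.≤ n
    right-≤ = ℕ.≤-trans (length-mono-≤ right⊆)

    left-AllPairs : ∀ {R : A → A → Set} → AllPairs R xs → AllPairs R (proj₁ yz)
    left-AllPairs = AllPairs-resp-⊆ left⊆

    right-AllPairs : ∀ {R : A → A → Set} → AllPairs R xs → AllPairs R (proj₂ yz)
    right-AllPairs = AllPairs-resp-⊆ right⊆

  splits-isSplit : ∀ xs → All (IsSplit xs) (splits xs)
  splits-isSplit []       = record { left⊆ = [] ; right⊆ = [] ; length-+ = refl ; covers = λ () ; disjoint = λ _ () } ∷ []
  splits-isSplit (x ∷ xs) = All-concatMap⁺ (putEither x) (splits-isSplit xs) extend
    where
    extend : ∀ {yz} → IsSplit xs yz → All (IsSplit (x ∷ xs)) (putEither x yz)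
    extend {ys , zs} s = record
        { left⊆ = refl ∷ left⊆ ; right⊆ = x ∷ʳ right⊆ ; length-+ = cong suc length-+
        ; covers = λ { (here refl) → inj₁ (here refl) ; (there a∈) → Data.Sum.map₁ there (covers a∈) }
        ; disjoint = λ { u (here refl , x∈zs) → Unique[x∷xs]⇒x∉xs u (lookup right⊆ x∈zs)
                       ; (_ ∷ u) (there a∈ys , a∈zs) → disjoint u (a∈ys , a∈zs) } }
      ∷ record
        { left⊆ = x ∷ʳ left⊆ ; right⊆ = refl ∷ right⊆
        ; length-+ = trans (ℕ.+-suc (length ys) (length zs)) (cong suc length-+)
        ; covers = λ { (here refl) → inj₂ (here refl) ; (there a∈) → Data.Sum.map₂ there (covers a∈) }
        ; disjoint = λ { u (x∈ys , here refl) → Unique[x∷xs]⇒x∉xs u (lookup left⊆ x∈ys)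
                       ; (_ ∷ u) (a∈ys , there a∈zs) → disjoint u (a∈ys , a∈zs) } }
      ∷ []
      where open IsSplit s

  sumOver-splits : ∀ xs (G : ℕ → ℕ → ℚ) →
                   sumOver (λ (ys , zs) → G (length ys) (length zs)) (splits xs) ≡ binomialSum G (length xs)
  sumOver-splits []       G = +-identityʳ _
  sumOver-splits (x ∷ xs) G = begin
    sumOver G′ (concatMap (putEither x) (splits xs))
      ≡⟨ sumOver-concatMap G′ (putEither x) (splits xs) ⟩
    sumOver (λ yz → sumOver G′ (putEither x yz)) (splits xs)
      ≡⟨ sumOver-cong (splits xs) (All.tabulate (λ {(ys , zs)} _ → cong (G (suc (length ys)) (length zs) +_) (+-identityʳ _))) ⟩
    sumOver (λ (ys , zs) → G (suc (length ys)) (length zs) + G (length ys) (suc (length zs))) (splits xs)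
      ≡⟨ sumOver-+ _ _ (splits xs) ⟩
    _ ≡⟨ cong₂ _+_ (sumOver-splits xs (λ i j → G (suc i) j)) (sumOver-splits xs (λ i j → G i (suc j))) ⟩
    binomialSum G (length (x ∷ xs)) ∎
    where
    G′ : Split → ℚ
    G′ (ys , zs) = G (length ys) (length zs)

  splits-unique : ∀ {xs} → Unique xs → Unique (splits xs)
  splits-unique {[]}     _           = [] ∷ []
  splits-unique {x ∷ xs} u@(_ ∷ uxs) = Unique-concatMap⁺ (putEither x) (splits-unique uxs)
    (λ { {ys , zs} _ → ((λ e → ℕ.1+n≢n (cong (length ∘ proj₁) e)) ∷ []) ∷ [] ∷ [] })
    injective
    where
    x∉xs : x ∉ xs
    x∉xs = Unique[x∷xs]⇒x∉xs u
    injective : ∀ {yz yz′ w} → yz ∈ splits xs → yz′ ∈ splits xs → w ∈ putEither x yz → w ∈ putEither x yz′ → yz ≡ yz′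
    injective {_ , _} {_ , _} _   _    (here refl)         (here refl)         = refl
    injective {_ , _} {_ , _} _   _    (there (here refl)) (there (here refl)) = refl
    injective {_ , _} {_ , _} _   yz′∈ (here refl)         (there (here refl)) =
      ⊥-elim (x∉xs (lookup (IsSplit.left⊆ (All.lookup (splits-isSplit xs) yz′∈)) (here refl)))
    injective {_ , _} {_ , _} yz∈ _    (there (here refl)) (here refl)         =
      ⊥-elim (x∉xs (lookup (IsSplit.left⊆ (All.lookup (splits-isSplit xs) yz∈)) (here refl)))

  splits-injective : ∀ xs → Unique xs → ∀ {yz yz′} → yz ∈ splits xs → yz′ ∈ splits xs →
                     (∀ {a} → a ∈ proj₁ yz → a ∈ proj₁ yz′) → (∀ {a} → a ∈ proj₁ yz′ → a ∈ proj₁ yz) → yz ≡ yz′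
  splits-injective []       _ (here refl) (here refl) _ _ = refl
  splits-injective (x ∷ xs) u@(_ ∷ uxs) yz∈ yz′∈ ⊆′ ⊇′
    with ∈-concatMap⁻ (putEither x) (splits xs) yz∈ | ∈-concatMap⁻ (putEither x) (splits xs) yz′∈
  ... | (ys , zs) , q∈ , here refl | (ys′ , zs′) , q′∈ , here refl =
    cong (λ (ys , zs) → (x ∷ ys , zs)) (splits-injective xs uxs q∈ q′∈ (dropHead q∈ ⊆′) (dropHead q′∈ ⊇′))
    where
    dropHead : ∀ {ys ys′ zs} → (ys , zs) ∈ splits xs → (∀ {a} → a ∈ x ∷ ys → a ∈ x ∷ ys′) → ∀ {a} → a ∈ ys → a ∈ ys′
    dropHead q∈ sub a∈ys with sub (there a∈ys)
    ... | here refl = ⊥-elim (Unique[x∷xs]⇒x∉xs u (lookup (IsSplit.left⊆ (All.lookup (splits-isSplit xs) q∈)) a∈ys))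
    ... | there a∈ys′ = a∈ys′
  ... | (ys , zs) , q∈ , there (here refl) | (ys′ , zs′) , q′∈ , there (here refl) =
    cong (λ (ys , zs) → (ys , x ∷ zs)) (splits-injective xs uxs q∈ q′∈ ⊆′ ⊇′)
  ... | (ys , zs) , q∈ , here refl | (ys′ , zs′) , q′∈ , there (here refl) =
    ⊥-elim (Unique[x∷xs]⇒x∉xs u (lookup (IsSplit.left⊆ (All.lookup (splits-isSplit xs) q′∈)) (⊆′ (here refl))))
  ... | (ys , zs) , q∈ , there (here refl) | (ys′ , zs′) , q′∈ , here refl =
    ⊥-elim (Unique[x∷xs]⇒x∉xs u (lookup (IsSplit.left⊆ (All.lookup (splits-isSplit xs) q∈)) (⊇′ (here refl))))

  splitBy : List A → List A → Split
  splitBy σ []       = [] , []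
  splitBy σ (x ∷ xs) with x ∈? σ
  ... | yes _ = x ∷ proj₁ (splitBy σ xs) , proj₂ (splitBy σ xs)
  ... | no  _ = proj₁ (splitBy σ xs) , x ∷ proj₂ (splitBy σ xs)

  splitBy-∈-splits : ∀ σ xs → splitBy σ xs ∈ splits xs
  splitBy-∈-splits σ []       = here refl
  splitBy-∈-splits σ (x ∷ xs) with x ∈? σ
  ... | yes _ = ∈-concatMap⁺ (putEither x) (splitBy-∈-splits σ xs) (here refl)
  ... | no  _ = ∈-concatMap⁺ (putEither x) (splitBy-∈-splits σ xs) (there (here refl))

  ∈-splitBy₁⁺ : ∀ σ xs {a} → a ∈ xs → a ∈ σ → a ∈ proj₁ (splitBy σ xs)
  ∈-splitBy₁⁺ σ (x ∷ xs) a∈ a∈σ with x ∈? σ | a∈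
  ... | yes _   | here refl = here refl
  ... | yes _   | there i   = there (∈-splitBy₁⁺ σ xs i a∈σ)
  ... | no  x∉σ | here refl = ⊥-elim (x∉σ a∈σ)
  ... | no  _   | there i   = ∈-splitBy₁⁺ σ xs i a∈σ

  ∈-splitBy₁⁻ : ∀ σ xs {a} → a ∈ proj₁ (splitBy σ xs) → a ∈ σ
  ∈-splitBy₁⁻ σ (x ∷ xs) a∈ with x ∈? σ | a∈
  ... | yes x∈σ | here refl = x∈σ
  ... | yes _   | there i   = ∈-splitBy₁⁻ σ xs i
  ... | no  _   | i         = ∈-splitBy₁⁻ σ xs i

  ∈-splitBy₂⁺ : ∀ σ xs {a} → a ∈ xs → a ∉ σ → a ∈ proj₂ (splitBy σ xs)
  ∈-splitBy₂⁺ σ (x ∷ xs) a∈ a∉σ with x ∈? σ | a∈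
  ... | yes x∈σ | here refl = ⊥-elim (a∉σ x∈σ)
  ... | yes _   | there i   = ∈-splitBy₂⁺ σ xs i a∉σ
  ... | no  _   | here refl = here refl
  ... | no  _   | there i   = there (∈-splitBy₂⁺ σ xs i a∉σ)

  ∈-splitBy₂⁻ : ∀ σ xs {a} → a ∈ proj₂ (splitBy σ xs) → a ∉ σ
  ∈-splitBy₂⁻ σ (x ∷ xs) a∈ with x ∈? σ | a∈
  ... | yes _   | i         = ∈-splitBy₂⁻ σ xs i
  ... | no  x∉σ | here refl = x∉σ
  ... | no  _   | there i   = ∈-splitBy₂⁻ σ xs i

module Arrangements where
  open import Data.Nat as ℕ using (zero; suc; _<_; _≤_; s≤s; _≟_)
  import Data.Nat.Properties as ℕ
  open import Data.List using (List; []; _∷_; length; _++_; map; concatMap; downFrom)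
  open import Data.List.Properties using (length-++; ++-cancelˡ; ∷-injectiveʳ)
  open import Data.List.Relation.Unary.All as All using (All; []; _∷_)
  import Data.List.Relation.Unary.All.Properties as All
  open import Data.List.Relation.Unary.Any using (here; there)
  open import Data.List.Relation.Unary.AllPairs as AllPairs using (AllPairs; []; _∷_)
  import Data.List.Relation.Unary.AllPairs.Properties as AllPairs
  open import Data.List.Relation.Unary.Unique.Propositional using (Unique)
  import Data.List.Relation.Unary.Unique.Propositional.Properties as Unique
  open import Data.List.Relation.Binary.Sublist.Propositional using (lookup)
  open import Data.List.Relation.Binary.Sublist.Propositional.Properties using (All-resp-⊆)
  open import Data.List.Membership.Propositional using (_∈_; _∉_)
  open import Data.List.Membership.Propositional.Properties using (∈-++⁺ˡ; ∈-++⁺ʳ; ∈-++⁻; ∈-map⁺; ∈-map⁻; ∈-∃++)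
  open import Data.Product using (∃₂; _×_; _,_; proj₁; proj₂)
  open import Data.Sum using (_⊎_; inj₁; inj₂)
  open import Data.Empty using (⊥-elim)
  open import Function using (_∘_)
  open import Relation.Binary.PropositionalEquality
  open ListLemmas
  open Splits _≟_

  -- A set of letters is represented by the strictly decreasing list of its elements.
  Descending : List ℕ → Set
  Descending = AllPairs (λ x y → y < x)

  Descending⇒Unique : ∀ {xs} → Descending xs → Unique xs
  Descending⇒Unique = AllPairs.map (λ y<x y≡x → ℕ.<-irrefl (sym y≡x) y<x)

  downFrom-descending : ∀ n → Descending (downFrom n)
  downFrom-descending n = AllPairs.applyDownFrom⁺₁ (λ i → i) n (λ j<i _ → j<i)

  around : ℕ → List (List ℕ) → List (List ℕ) → List (List ℕ)
  around m σs τs = concatMap (λ σ → map (λ τ → σ ++ m ∷ τ) τs) σs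

  All-around⁺ : ∀ {P Q R : List ℕ → Set} {m σs τs} → All P σs → All Q τs →
                (∀ {σ τ} → P σ → Q τ → R (σ ++ m ∷ τ)) → All R (around m σs τs)
  All-around⁺ {m = m} {τs = τs} Pσs Qτs f =
    All-concatMap⁺ (λ σ → map (λ τ → σ ++ m ∷ τ) τs) Pσs (λ Pσ → All.map⁺ (All.map (f Pσ) Qτs))

  ∈-around⁺ : ∀ {m σs τs σ τ} → σ ∈ σs → τ ∈ τs → σ ++ m ∷ τ ∈ around m σs τs
  ∈-around⁺ {m} {τs = τs} σ∈ τ∈ = ∈-concatMap⁺ (λ σ → map (λ τ → σ ++ m ∷ τ) τs) σ∈ (∈-map⁺ (λ τ → _ ++ m ∷ τ) τ∈)

  ∈-around⁻ : ∀ {m} σs {τs π} → π ∈ around m σs τs → ∃₂ λ σ τ → σ ∈ σs × τ ∈ τs × π ≡ σ ++ m ∷ τ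
  ∈-around⁻ {m} σs {τs} π∈ with ∈-concatMap⁻ (λ σ → map (λ τ → σ ++ m ∷ τ) τs) σs π∈
  ... | σ , σ∈ , π∈σ with ∈-map⁻ (λ τ → σ ++ m ∷ τ) π∈σ
  ... | τ , τ∈ , π≡ = σ , τ , σ∈ , τ∈ , π≡

  -- The fuel only has to exceed length X.
  arrangements : ℕ → List ℕ → List (List ℕ)
  arrangements _       []       = [] ∷ []
  arrangements zero    (_ ∷ _)  = []
  arrangements (suc f) (m ∷ xs) = concatMap (λ (ys , zs) → around m (arrangements f ys) (arrangements f zs)) (splits xs)

  All-arrangements : ∀ (R : List ℕ → List ℕ → Set) → R [] [] →
                     (∀ {m xs ys zs σ τ} → IsSplit xs (ys , zs) → R ys σ → R zs τ → R (m ∷ xs) (σ ++ m ∷ τ)) →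
                     ∀ f X → All (R X) (arrangements f X)
  All-arrangements R base step _       []       = base ∷ []
  All-arrangements R base step zero    (_ ∷ _)  = []
  All-arrangements R base step (suc f) (m ∷ xs) = All-concatMap⁺ _ (splits-isSplit xs)
    (λ {(ys , zs)} s → All-around⁺ (All-arrangements R base step f ys) (All-arrangements R base step f zs) (step s))

  arrangements-length : ∀ f X → All (λ π → length π ≡ length X) (arrangements f X)
  arrangements-length = All-arrangements (λ X π → length π ≡ length X) refl
    λ {_} {_} {ys} {zs} {σ} {τ} s |σ| |τ| → begin
      length (σ ++ _ ∷ τ)             ≡⟨ length-++ σ ⟩
      length σ ℕ.+ suc (length τ)     ≡⟨ cong₂ (λ a b → a ℕ.+ suc b) |σ| |τ| ⟩
      length ys ℕ.+ suc (length zs)   ≡⟨ ℕ.+-suc (length ys) (length zs) ⟩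
      suc (length ys ℕ.+ length zs)   ≡⟨ cong suc (IsSplit.length-+ s) ⟩
      suc _                           ∎
    where open ≡-Reasoning

  ⊆-around : ∀ {m xs ys zs σ τ} → IsSplit xs (ys , zs) → All (_∈ ys) σ → All (_∈ zs) τ → All (_∈ m ∷ xs) (σ ++ m ∷ τ)
  ⊆-around s σ⊆ τ⊆ = All.++⁺ (All.map (there ∘ lookup (IsSplit.left⊆ s)) σ⊆)
                             (here refl ∷ All.map (there ∘ lookup (IsSplit.right⊆ s)) τ⊆)

  arrangements-⊆ : ∀ f X → All (All (_∈ X)) (arrangements f X)
  arrangements-⊆ = All-arrangements (λ X → All (_∈ X)) [] ⊆-around

  arrangements-⊇ : ∀ f X → All (λ π → All (_∈ π) X) (arrangements f X)
  arrangements-⊇ = All-arrangements (λ X π → All (_∈ π) X) []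
    λ {_} {xs} {_} {_} {σ} s σ⊇ τ⊇ →
      ∈-++⁺ʳ σ (here refl) ∷ All.tabulate (λ a∈xs → case-covers σ⊇ τ⊇ (IsSplit.covers s a∈xs))
    where
    case-covers : ∀ {σ τ ys zs m a} → All (_∈ σ) ys → All (_∈ τ) zs → a ∈ ys ⊎ a ∈ zs → a ∈ σ ++ m ∷ τ
    case-covers σ⊇ τ⊇ (inj₁ a∈ys) = ∈-++⁺ˡ (All.lookup σ⊇ a∈ys)
    case-covers {σ} σ⊇ τ⊇ (inj₂ a∈zs) = ∈-++⁺ʳ σ (there (All.lookup τ⊇ a∈zs))

  arrangements-Unique : ∀ f X → Descending X → All Unique (arrangements f X)
  arrangements-Unique f X dX = All.map (λ (_ , unique) → unique dX) (All-arrangements R ([] , λ _ → []) step f X)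
    where
    R : List ℕ → List ℕ → Set
    R X π = All (_∈ X) π × (Descending X → Unique π)
    step : ∀ {m xs ys zs σ τ} → IsSplit xs (ys , zs) → R ys σ → R zs τ → R (m ∷ xs) (σ ++ m ∷ τ)
    step {m} {σ = σ} {τ} s (σ⊆ , uσ) (τ⊆ , uτ) = ⊆-around s σ⊆ τ⊆ , λ { (m>xs ∷ dxs) →
      let σ<m : ∀ {a} → a ∈ σ → a < m
          σ<m a∈σ = All.lookup m>xs (lookup (IsSplit.left⊆ s) (All.lookup σ⊆ a∈σ))
          τ<m : ∀ {a} → a ∈ τ → a < m
          τ<m a∈τ = All.lookup m>xs (lookup (IsSplit.right⊆ s) (All.lookup τ⊆ a∈τ))
      in Unique.++⁺ (uσ (IsSplit.left-AllPairs s dxs))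
                    (All.tabulate (λ a∈τ m≡a → ℕ.<-irrefl (sym m≡a) (τ<m a∈τ)) ∷ uτ (IsSplit.right-AllPairs s dxs))
                    λ { (a∈σ , here refl) → ℕ.<-irrefl refl (σ<m a∈σ)
                      ; (a∈σ , there a∈τ) → IsSplit.disjoint s (Descending⇒Unique dxs) (All.lookup σ⊆ a∈σ , All.lookup τ⊆ a∈τ) } }

  around-unique : ∀ {m σs τs} → All (m ∉_) σs → Unique σs → Unique τs → Unique (around m σs τs)
  around-unique {m} {σs} {τs} m∉σs uσs uτs =
    Unique-concatMap⁺ (λ σ → map (λ τ → σ ++ m ∷ τ) τs) uσs
      (λ {σ} _ → Unique.map⁺ (∷-injectiveʳ ∘ ++-cancelˡ σ _ _) uτs)
      injective
    where
    injective : ∀ {σ σ′ π} → σ ∈ σs → σ′ ∈ σs → π ∈ map (λ τ → σ ++ m ∷ τ) τs → π ∈ map (λ τ → σ′ ++ m ∷ τ) τs → σ ≡ σ′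
    injective {σ} {σ′} σ∈ σ′∈ π∈ π∈′ with ∈-map⁻ (λ τ → σ ++ m ∷ τ) π∈ | ∈-map⁻ (λ τ → σ′ ++ m ∷ τ) π∈′
    ... | _ , _ , π≡ | _ , _ , π≡′ =
      proj₁ (++-∷-injective σ σ′ (All.lookup m∉σs σ∈) (All.lookup m∉σs σ′∈) (trans (sym π≡) π≡′))

  max∉arrangements : ∀ f {m ys} → All (_< m) ys → All (m ∉_) (arrangements f ys)
  max∉arrangements f ys<m = All.map (λ σ⊆ m∈σ → ℕ.<-irrefl refl (All.lookup ys<m (All.lookup σ⊆ m∈σ))) (arrangements-⊆ f _)

  arrangements-unique : ∀ f X → Descending X → Unique (arrangements f X)
  arrangements-unique _       []       _            = [] ∷ []
  arrangements-unique zero    (_ ∷ _)  _            = []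
  arrangements-unique (suc f) (m ∷ xs) (m>xs ∷ dxs) =
    Unique-concatMap⁺ _ (splits-unique uxs)
      (λ {(ys , zs)} yz∈ → let s = All.lookup (splits-isSplit xs) yz∈ in
        around-unique (m∉ yz∈)
                      (arrangements-unique f ys (IsSplit.left-AllPairs s dxs))
                      (arrangements-unique f zs (IsSplit.right-AllPairs s dxs)))
      across
    where
    uxs : Unique xs
    uxs = Descending⇒Unique dxs
    m∉ : ∀ {ys zs} → (ys , zs) ∈ splits xs → All (m ∉_) (arrangements f ys)
    m∉ yz∈ = max∉arrangements f (All-resp-⊆ (IsSplit.left⊆ (All.lookup (splits-isSplit xs) yz∈)) m>xs)
    across : ∀ {yz yz′ π} → yz ∈ splits xs → yz′ ∈ splits xs →
             π ∈ around m (arrangements f (proj₁ yz)) (arrangements f (proj₂ yz)) →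
             π ∈ around m (arrangements f (proj₁ yz′)) (arrangements f (proj₂ yz′)) → yz ≡ yz′
    across {ys , _} {ys′ , _} yz∈ yz′∈ π∈ π∈′ with ∈-around⁻ (arrangements f ys) π∈ | ∈-around⁻ (arrangements f ys′) π∈′
    ... | σ , _ , σ∈ , _ , refl | σ′ , _ , σ′∈ , _ , π≡′
      with ++-∷-injective σ σ′ (All.lookup (m∉ yz∈) σ∈) (All.lookup (m∉ yz′∈) σ′∈) π≡′
    ... | refl , refl = splits-injective xs uxs yz∈ yz′∈
      (λ a∈ys → All.lookup (All.lookup (arrangements-⊆ f ys′) σ′∈)
                           (All.lookup (All.lookup (arrangements-⊇ f ys) σ∈) a∈ys))
      (λ a∈ys′ → All.lookup (All.lookup (arrangements-⊆ f ys) σ∈)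
                            (All.lookup (All.lookup (arrangements-⊇ f ys′) σ′∈) a∈ys′))

  arrangements-fuel : ∀ f g X → length X ≤ f → length X ≤ g → arrangements f X ≡ arrangements g X
  arrangements-fuel _       _       []       _           _           = refl
  arrangements-fuel (suc f) (suc g) (m ∷ xs) (s≤s |xs|≤f) (s≤s |xs|≤g) = concatMap-cong (splits xs)
    (All.map (λ {(ys , zs)} s → cong₂ (around m)
        (arrangements-fuel f g ys (IsSplit.left-≤ s |xs|≤f) (IsSplit.left-≤ s |xs|≤g))
        (arrangements-fuel f g zs (IsSplit.right-≤ s |xs|≤f) (IsSplit.right-≤ s |xs|≤g)))
      (splits-isSplit xs))

  arrangements-complete : ∀ f X → Descending X → length X ≤ f →
                          ∀ {π} → Unique π → All (_∈ X) π → All (_∈ π) X → π ∈ arrangements f X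
  arrangements-complete f       []       _            _            {[]}    _  _          _ = here refl
  arrangements-complete f       []       _            _            {_ ∷ _} _  (() ∷ _)   _
  arrangements-complete (suc f) (m ∷ xs) (m>xs ∷ dxs) (s≤s |xs|≤f) uπ π⊆ (m∈π ∷ xs⊆π)
    with σ , τ , refl ← ∈-∃++ m∈π = placeMax σ τ uπ π⊆ xs⊆π
    where
    placeMax : ∀ σ τ → Unique (σ ++ m ∷ τ) → All (_∈ m ∷ xs) (σ ++ m ∷ τ) → All (_∈ σ ++ m ∷ τ) xs →
               σ ++ m ∷ τ ∈ arrangements (suc f) (m ∷ xs)
    placeMax σ τ uπ π⊆ xs⊆π with uσ , (m∉τ ∷ uτ) , disjoint ← Unique-++⁻ σ uπ =
      ∈-concatMap⁺ _ (splitBy-∈-splits σ xs) (∈-around⁺ σ∈ τ∈)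
      where
      ys zs : List ℕ
      ys = proj₁ (splitBy σ xs)
      zs = proj₂ (splitBy σ xs)
      s : IsSplit xs (ys , zs)
      s = All.lookup (splits-isSplit xs) (splitBy-∈-splits σ xs)
      ∈xs : ∀ {a} → a ∈ σ ++ m ∷ τ → a ≢ m → a ∈ xs
      ∈xs a∈π a≢m with All.lookup π⊆ a∈π
      ... | here a≡m  = ⊥-elim (a≢m a≡m)
      ... | there a∈ = a∈
      σ∈ : σ ∈ arrangements f ys
      σ∈ = arrangements-complete f ys (IsSplit.left-AllPairs s dxs) (IsSplit.left-≤ s |xs|≤f) uσ
        (All.tabulate (λ a∈σ → ∈-splitBy₁⁺ σ xs (∈xs (∈-++⁺ˡ a∈σ) (λ { refl → disjoint (a∈σ , here refl) })) a∈σ))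
        (All.tabulate (∈-splitBy₁⁻ σ xs))
      τ∈ : τ ∈ arrangements f zs
      τ∈ = arrangements-complete f zs (IsSplit.right-AllPairs s dxs) (IsSplit.right-≤ s |xs|≤f) uτ
        (All.tabulate (λ a∈τ → ∈-splitBy₂⁺ σ xs (∈xs (∈-++⁺ʳ σ (there a∈τ)) (λ { refl → All.lookup m∉τ a∈τ refl }))
                                              (λ a∈σ → disjoint (a∈σ , there a∈τ))))
        (All.tabulate (λ a∈zs → inτ (∈-splitBy₂⁻ σ xs a∈zs) (lookup (IsSplit.right⊆ s) a∈zs)))
        where
        inτ : ∀ {a} → a ∉ σ → a ∈ xs → a ∈ τ
        inτ a∉σ a∈xs with ∈-++⁻ σ (All.lookup xs⊆π a∈xs)
        ... | inj₁ a∈σ         = ⊥-elim (a∉σ a∈σ)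
        ... | inj₂ (here refl) = ⊥-elim (ℕ.<-irrefl refl (All.lookup m>xs a∈xs))
        ... | inj₂ (there a∈τ) = a∈τ

module Pigeonhole {A : Set} (_≟_ : DecidableEquality A) where
  open import Data.Nat using (_≤_; _<_; z≤n; s≤s)
  import Data.Nat.Properties as ℕ
  open import Data.List using (List; []; _∷_; length; filter)
  open import Data.List.Properties using (filter-notAll)
  open import Data.List.Relation.Unary.All as All using (All; []; _∷_)
  open import Data.List.Relation.Unary.Any as Any using (Any)
  open import Data.List.Relation.Unary.AllPairs using (_∷_)
  open import Data.List.Relation.Unary.Unique.Propositional using (Unique)
  open import Data.List.Membership.Propositional using (_∈_; _∉_)
  open import Data.List.Membership.Propositional.Properties using (∈-filter⁺)
  open import Data.List.Membership.DecPropositional _≟_ using (_∈?_)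
  open import Data.Empty using (⊥-elim)
  open import Relation.Nullary using (yes; no; ¬?)
  open import Function using (case_of_)
  open import Relation.Binary.PropositionalEquality

  private
    others : A → List A → List A
    others b = filter (λ y → ¬? (y ≟ b))

    length-others : ∀ {b ys} → b ∈ ys → length (others b ys) < length ys
    length-others {b} {ys} b∈ys = filter-notAll (λ y → ¬? (y ≟ b)) ys (Any.map (λ b≡y y≢b → y≢b (sym b≡y)) b∈ys)

    ⊆-others : ∀ {b xs ys} → b ∉ xs → All (_∈ ys) xs → All (_∈ others b ys) xs
    ⊆-others {b} b∉xs xs⊆ys = All.tabulate (λ c∈xs → ∈-filter⁺ (λ y → ¬? (y ≟ b)) (All.lookup xs⊆ys c∈xs)
                                                    (λ { refl → b∉xs c∈xs }))

  Unique⇒length≤ : ∀ {xs ys} → Unique xs → All (_∈ ys) xs → length xs ≤ length ys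
  Unique⇒length≤ {[]}     _          _              = z≤n
  Unique⇒length≤ {b ∷ xs} (b∉ ∷ uxs) (b∈ys ∷ xs⊆ys) = ℕ.≤-trans
    (s≤s (Unique⇒length≤ uxs (⊆-others (λ b∈xs → All.lookup b∉ b∈xs refl) xs⊆ys))) (length-others b∈ys)

  Unique⇒⊇ : ∀ {xs ys} → Unique xs → All (_∈ ys) xs → length ys ≤ length xs → All (_∈ xs) ys
  Unique⇒⊇ {xs} uxs xs⊆ys |ys|≤|xs| = All.tabulate λ {a} a∈ys → case a ∈? xs of λ where
    (yes a∈xs) → a∈xs
    (no  a∉xs) → ⊥-elim (ℕ.<-irrefl refl (ℕ.≤-trans (s≤s (Unique⇒length≤ uxs (⊆-others a∉xs xs⊆ys)))
                                                     (ℕ.≤-trans (length-others a∈ys) |ys|≤|xs|)))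

module Permutations where
  open import Data.Nat as ℕ using (zero; suc; _<_; _≟_)
  import Data.Nat.Properties as ℕ
  open import Data.List using (List; []; _∷_; length; map; applyUpTo; downFrom)
  open import Data.List.Properties using (length-downFrom; ∷-injectiveˡ; ∷-injectiveʳ)
  open import Data.List.Relation.Unary.All as All using (All; []; _∷_)
  open import Data.List.Relation.Unary.Any using (here)
  open import Data.List.Relation.Unary.AllPairs using ([]; _∷_)
  open import Data.List.Relation.Unary.Unique.Propositional using (Unique)
  import Data.List.Relation.Unary.Unique.Propositional.Properties as Unique
  open import Data.List.Relation.Unary.Unique.DecPropositional _≟_ using (unique?)
  open import Data.List.Membership.Propositional using (_∈_)
  open import Data.List.Membership.Propositional.Properties
    using (∈-map⁺; ∈-map⁻; ∈-filter⁺; ∈-filter⁻; ∈-downFrom⁺; ∈-downFrom⁻; ∈-upTo⁺; ∈-upTo⁻)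
  open import Data.List.Membership.Propositional.Properties.WithK using (unique∧set⇒bag)
  open import Data.List.Relation.Binary.BagAndSetEquality using (∼bag⇒↭)
  open import Data.List.Relation.Binary.Permutation.Propositional using (_↭_)
  open import Data.Product using (_×_; _,_)
  open import Function.Bundles using (mk⇔)
  open import Relation.Binary.PropositionalEquality
  open ListLemmas
  open Arrangements
  open Pigeonhole _≟_

  prependLetter : ℕ → List ℕ → List (List ℕ)
  prependLetter n w = map (λ a → a ∷ w) (applyUpTo (λ i → i) n)

  ∈-words⁻ : ∀ n k {π} → π ∈ words n k → length π ≡ k × All (_< n) π
  ∈-words⁻ n zero    (here refl) = refl , []
  ∈-words⁻ n (suc k) π∈
    with w , w∈ , π∈′ ← ∈-concatMap⁻ (prependLetter n) (words n k) π∈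
    with a , a∈ , refl ← ∈-map⁻ (λ a → a ∷ w) π∈′
    with |w| , w<n ← ∈-words⁻ n k w∈ = cong suc |w| , ∈-upTo⁻ a∈ ∷ w<n

  ∈-words⁺ : ∀ n {π} → All (_< n) π → π ∈ words n (length π)
  ∈-words⁺ n []              = here refl
  ∈-words⁺ n (a<n ∷ π<n) = ∈-concatMap⁺ (prependLetter n) (∈-words⁺ n π<n) (∈-map⁺ (λ a → a ∷ _) (∈-upTo⁺ a<n))

  words-unique : ∀ n k → Unique (words n k)
  words-unique n zero    = [] ∷ []
  words-unique n (suc k) = Unique-concatMap⁺ (prependLetter n) (words-unique n k)
    (λ _ → Unique.map⁺ ∷-injectiveˡ (Unique.upTo⁺ n)) injective
    where
    injective : ∀ {w w′ π} → w ∈ words n k → w′ ∈ words n k → π ∈ prependLetter n w → π ∈ prependLetter n w′ → w ≡ w′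
    injective {w} {w′} _ _ π∈ π∈′ with ∈-map⁻ (λ a → a ∷ w) π∈ | ∈-map⁻ (λ a → a ∷ w′) π∈′
    ... | _ , _ , π≡ | _ , _ , π≡′ = ∷-injectiveʳ (trans (sym π≡) π≡′)

  perms↭arrangements : ∀ n → perms n ↭ arrangements n (downFrom n)
  perms↭arrangements n = ∼bag⇒↭ (unique∧set⇒bag (Unique.filter⁺ unique? (words-unique n n))
                                                 (arrangements-unique n (downFrom n) (downFrom-descending n))
                                                 (mk⇔ complete sound))
    where
    |downFrom|≡n : length (downFrom n) ≡ n
    |downFrom|≡n = length-downFrom n
    complete : ∀ {π} → π ∈ perms n → π ∈ arrangements n (downFrom n)
    complete π∈
      with π∈words , uπ ← ∈-filter⁻ unique? π∈
      with |π|≡n , π<n ← ∈-words⁻ n n π∈words =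
      arrangements-complete n (downFrom n) (downFrom-descending n) (ℕ.≤-reflexive |downFrom|≡n) uπ
        (All.map ∈-downFrom⁺ π<n)
        (Unique⇒⊇ uπ (All.map ∈-downFrom⁺ π<n) (ℕ.≤-reflexive (trans |downFrom|≡n (sym |π|≡n))))
    sound : ∀ {π} → π ∈ arrangements n (downFrom n) → π ∈ perms n
    sound {π} π∈ = ∈-filter⁺ unique?
      (subst (λ k → π ∈ words n k) (trans (All.lookup (arrangements-length n (downFrom n)) π∈) |downFrom|≡n)
             (∈-words⁺ n (All.map ∈-downFrom⁻ (All.lookup (arrangements-⊆ n (downFrom n)) π∈))))
      (All.lookup (arrangements-Unique n (downFrom n) (downFrom-descending n)) π∈)

module Weights (t : ℚ) where
  open import Data.Nat as ℕ using (zero; suc; _<_; _≤_; s≤s; _≟_)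
  import Data.Nat.Properties as ℕ
  open import Data.List using (List; []; _∷_; length; _++_; map; downFrom)
  open import Data.List.Properties using (length-downFrom)
  open import Data.List.Relation.Unary.All as All using (All; []; _∷_)
  open import Data.List.Relation.Unary.AllPairs using (_∷_)
  open import Data.List.Relation.Binary.Sublist.Propositional using (_⊆_)
  open import Data.List.Relation.Binary.Sublist.Propositional.Properties using (All-resp-⊆)
  open import Data.Product using (_×_; _,_)
  open import Data.Rational using (_*_)
  open import Relation.Binary.PropositionalEquality
  open ≡-Reasoning
  open RationalArithmetic using (^ℚ-homo-*)
  open ListSums
  open Convolution using (binomialSum)
  open Statistics using (rdasc′; rdascAtMax; rdasc′-++-max)
  open Splits _≟_
  open Arrangements

  weight : (List ℕ → ℕ) → ℕ → List ℕ → ℚ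
  weight stat f X = sumOver (λ π → t ^ℚ stat π) (arrangements f X)

  permWeight : (List ℕ → ℕ) → ℕ → ℚ
  permWeight stat n = weight stat n (downFrom n)

  DecomposesAtMax : (List ℕ → ℕ) → (ℕ → ℕ → ℕ) → Set
  DecomposesAtMax stat E = ∀ σ m τ → All (_< m) σ → All (_< m) τ →
                           stat (σ ++ m ∷ τ) ≡ stat σ ℕ.+ (rdasc′ τ ℕ.+ E (length σ) (length τ))

  WeightByLength : (List ℕ → ℕ) → ℕ → Set
  WeightByLength stat f = ∀ X → Descending X → length X ≤ f → weight stat f X ≡ permWeight stat (length X)

  module _ {stat : List ℕ → ℕ} {E : ℕ → ℕ → ℕ} (decomposes : DecomposesAtMax stat E) where

    weight-around : ∀ f {m xs ys zs} → All (_< m) xs → IsSplit xs (ys , zs) →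
                    sumOver (λ π → t ^ℚ stat π) (around m (arrangements f ys) (arrangements f zs))
                    ≡ weight stat f ys * (weight rdasc′ f zs * t ^ℚ E (length ys) (length zs))
    weight-around f {m} {xs} {ys} {zs} xs<m s = begin
      sumOver w (around m σs τs)
        ≡⟨ sumOver-concatMap w (λ σ → map (λ τ → σ ++ m ∷ τ) τs) σs ⟩
      sumOver (λ σ → sumOver w (map (λ τ → σ ++ m ∷ τ) τs)) σs
        ≡⟨ sumOver-cong σs (All.tabulate (λ {σ} _ → sumOver-map w (λ τ → σ ++ m ∷ τ) τs)) ⟩
      sumOver (λ σ → sumOver (λ τ → w (σ ++ m ∷ τ)) τs) σs
        ≡⟨ sumOver-cong σs (All.map (λ (σ<m , |σ|) → sumOver-cong τs (All.map (λ (τ<m , |τ|) → split σ<m |σ| τ<m |τ|) τs-facts))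
                                    σs-facts) ⟩
      sumOver (λ σ → sumOver (λ τ → t ^ℚ stat σ * (t ^ℚ rdasc′ τ * c)) τs) σs
        ≡⟨ sumOver-cong σs (All.tabulate (λ {σ} _ → trans (sumOver-*ˡ (t ^ℚ stat σ) _ τs)
                                                          (cong (t ^ℚ stat σ *_) (sumOver-*ʳ c _ τs)))) ⟩
      sumOver (λ σ → t ^ℚ stat σ * (weight rdasc′ f zs * c)) σs
        ≡⟨ sumOver-*ʳ (weight rdasc′ f zs * c) _ σs ⟩
      weight stat f ys * (weight rdasc′ f zs * c) ∎
      where
      w : List ℕ → ℚ
      w π = t ^ℚ stat π
      σs τs : List (List ℕ)
      σs = arrangements f ys
      τs = arrangements f zs
      c : ℚ
      c = t ^ℚ E (length ys) (length zs)
      letters<m : ∀ {us} → us ⊆ xs → All (All (_< m)) (arrangements f us)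
      letters<m sub = All.map (All.map (All.lookup (All-resp-⊆ sub xs<m))) (arrangements-⊆ f _)
      σs-facts : All (λ σ → All (_< m) σ × length σ ≡ length ys) σs
      σs-facts = All.zip (letters<m (IsSplit.left⊆ s) , arrangements-length f ys)
      τs-facts : All (λ τ → All (_< m) τ × length τ ≡ length zs) τs
      τs-facts = All.zip (letters<m (IsSplit.right⊆ s) , arrangements-length f zs)
      split : ∀ {σ τ} → All (_< m) σ → length σ ≡ length ys → All (_< m) τ → length τ ≡ length zs →
              w (σ ++ m ∷ τ) ≡ t ^ℚ stat σ * (t ^ℚ rdasc′ τ * c)
      split {σ} {τ} σ<m |σ| τ<m |τ| = begin
        t ^ℚ stat (σ ++ m ∷ τ)                                    ≡⟨ cong (t ^ℚ_) (decomposes σ m τ σ<m τ<m) ⟩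
        t ^ℚ (stat σ ℕ.+ (rdasc′ τ ℕ.+ E (length σ) (length τ)))  ≡⟨ ^ℚ-homo-* t (stat σ) _ ⟩
        t ^ℚ stat σ * t ^ℚ (rdasc′ τ ℕ.+ E (length σ) (length τ)) ≡⟨ cong (t ^ℚ stat σ *_) (^ℚ-homo-* t (rdasc′ τ) _) ⟩
        t ^ℚ stat σ * (t ^ℚ rdasc′ τ * t ^ℚ E (length σ) (length τ))
          ≡⟨ cong (λ e → t ^ℚ stat σ * (t ^ℚ rdasc′ τ * t ^ℚ e)) (cong₂ E |σ| |τ|) ⟩
        t ^ℚ stat σ * (t ^ℚ rdasc′ τ * c) ∎

    weight-suc : ∀ f → WeightByLength stat f → WeightByLength rdasc′ f →
                 ∀ m xs → Descending (m ∷ xs) → length xs ≤ f →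
                 weight stat (suc f) (m ∷ xs) ≡ binomialSum (λ i j → permWeight stat i * (permWeight rdasc′ j * t ^ℚ E i j)) (length xs)
    weight-suc f byLength byLength-rdasc′ m xs (m>xs ∷ dxs) |xs|≤f = begin
      weight stat (suc f) (m ∷ xs)
        ≡⟨ sumOver-concatMap (λ π → t ^ℚ stat π) _ (splits xs) ⟩
      sumOver (λ (ys , zs) → sumOver (λ π → t ^ℚ stat π) (around m (arrangements f ys) (arrangements f zs))) (splits xs)
        ≡⟨ sumOver-cong (splits xs) (All.map (λ {(ys , zs)} s → trans (weight-around f m>xs s) (cong₂ (λ a b → a * (b * _))
             (byLength ys (IsSplit.left-AllPairs s dxs) (IsSplit.left-≤ s |xs|≤f))
             (byLength-rdasc′ zs (IsSplit.right-AllPairs s dxs) (IsSplit.right-≤ s |xs|≤f))))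
             (splits-isSplit xs)) ⟩
      sumOver (λ (ys , zs) → permWeight stat (length ys) * (permWeight rdasc′ (length zs) * t ^ℚ E (length ys) (length zs))) (splits xs)
        ≡⟨ sumOver-splits xs (λ i j → permWeight stat i * (permWeight rdasc′ j * t ^ℚ E i j)) ⟩
      binomialSum (λ i j → permWeight stat i * (permWeight rdasc′ j * t ^ℚ E i j)) (length xs) ∎

    -- weight-suc depends on m ∷ xs only through length xs, so m ∷ xs may be traded for downFrom (1 + length xs).
    weightByLength-suc : ∀ f → WeightByLength stat f → WeightByLength rdasc′ f → WeightByLength stat (suc f)
    weightByLength-suc f byLength byLength-rdasc′ []       _ _             = refl
    weightByLength-suc f byLength byLength-rdasc′ (m ∷ xs) d (s≤s |xs|≤f) = begin
      weight stat (suc f) (m ∷ xs)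
        ≡⟨ weight-suc f byLength byLength-rdasc′ m xs d |xs|≤f ⟩
      binomialSum G (length xs)
        ≡⟨ cong (binomialSum G) (length-downFrom (length xs)) ⟨
      binomialSum G (length (downFrom (length xs)))
        ≡⟨ weight-suc f byLength byLength-rdasc′ (length xs) (downFrom (length xs))
                      (downFrom-descending (suc (length xs))) (subst (_≤ f) (sym (length-downFrom (length xs))) |xs|≤f) ⟨
      weight stat (suc f) (downFrom (suc (length xs)))
        ≡⟨ cong (sumOver (λ π → t ^ℚ stat π)) (arrangements-fuel (suc f) (suc (length xs)) (downFrom (suc (length xs)))
             (s≤s (subst (_≤ f) (sym (length-downFrom (length xs))) |xs|≤f)) (ℕ.≤-reflexive (length-downFrom (suc (length xs))))) ⟩
      permWeight stat (suc (length xs)) ∎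
      where
      G : ℕ → ℕ → ℚ
      G i j = permWeight stat i * (permWeight rdasc′ j * t ^ℚ E i j)

  weightByLength-rdasc′ : ∀ f → WeightByLength rdasc′ f
  weightByLength-rdasc′ zero    [] _ _ = refl
  weightByLength-rdasc′ (suc f) =
    weightByLength-suc {rdasc′} {rdascAtMax} rdasc′-++-max f (weightByLength-rdasc′ f) (weightByLength-rdasc′ f)

  module _ {stat : List ℕ → ℕ} {E : ℕ → ℕ → ℕ} (decomposes : DecomposesAtMax stat E) where

    weightByLength : ∀ f → WeightByLength stat f
    weightByLength zero    [] _ _ = refl
    weightByLength (suc f) = weightByLength-suc {stat} {E} decomposes f (weightByLength f) (weightByLength-rdasc′ f)

    permWeight-suc : ∀ n → permWeight stat (suc n) ≡ binomialSum (λ i j → permWeight stat i * (permWeight rdasc′ j * t ^ℚ E i j)) n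
    permWeight-suc n = trans
      (weight-suc {stat} {E} decomposes n (weightByLength n) (weightByLength-rdasc′ n) n (downFrom n)
                  (downFrom-descending (suc n)) (ℕ.≤-reflexive (length-downFrom n)))
      (cong (binomialSum _) (length-downFrom n))

module Recurrences (t : ℚ) where
  open import Data.Nat as ℕ using (zero; suc)
  import Data.List.Relation.Unary.All as All
  open import Data.Rational using (1ℚ; 0ℚ; _+_; _-_; _*_)
  open import Data.Rational.Solver using (module +-*-Solver)
  open +-*-Solver using (solve; con; _:+_; _:-_; _:*_; _:=_)
  open import Relation.Binary.PropositionalEquality
  open ≡-Reasoning
  open ListSums using (sumOver-cong; sumOver-↭)
  open Convolution
  open Statistics
  open Permutations using (perms↭arrangements)
  open Weights t

  α β : Series
  α = permWeight rdasc′
  β = permWeight lrdasc′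

  α-at-max : ∀ i j → α i * (α j * t ^ℚ rdascAtMax i j) ≡ α i * α j + (t - 1ℚ) * ((α i - δ₀ i) * δ₀ j)
  α-at-max zero    zero    = solve 1 (λ t → con 1ℚ :* (con 1ℚ :* con 1ℚ)
                                      := con 1ℚ :* con 1ℚ :+ (t :- con 1ℚ) :* ((con 1ℚ :- con 1ℚ) :* con 1ℚ)) refl t
  α-at-max zero    (suc j) = solve 3 (λ t a b → a :* (b :* con 1ℚ)
                                      := a :* b :+ (t :- con 1ℚ) :* ((a :- con 1ℚ) :* con 0ℚ)) refl t (α 0) (α (suc j))
  α-at-max (suc i) zero    = solve 2 (λ t a → a :* (con 1ℚ :* (t :* con 1ℚ))
                                      := a :* con 1ℚ :+ (t :- con 1ℚ) :* ((a :- con 0ℚ) :* con 1ℚ)) refl t (α (suc i))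
  α-at-max (suc i) (suc j) = solve 3 (λ t a b → a :* (b :* con 1ℚ)
                                      := a :* b :+ (t :- con 1ℚ) :* ((a :- con 0ℚ) :* con 0ℚ)) refl t (α (suc i)) (α (suc j))

  β-at-max : ∀ i j → β i * (α j * t ^ℚ lrdascAtMax j) ≡ β i * α j + (t - 1ℚ) * (β i * δ₀ j)
  β-at-max i zero    = solve 2 (λ t a → a :* (con 1ℚ :* (t :* con 1ℚ))
                                := a :* con 1ℚ :+ (t :- con 1ℚ) :* (a :* con 1ℚ)) refl t (β i)
  β-at-max i (suc j) = solve 3 (λ t a b → a :* (b :* con 1ℚ)
                                := a :* b :+ (t :- con 1ℚ) :* (a :* con 0ℚ)) refl t (β i) (α (suc j))

  α-suc : ∀ n → α (suc n) ≡ (α ⋆ α) n + (t - 1ℚ) * (α n - δ₀ n)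
  α-suc n = begin
    α (suc n)
      ≡⟨ permWeight-suc {rdasc′} {rdascAtMax} rdasc′-++-max n ⟩
    binomialSum (λ i j → α i * (α j * t ^ℚ rdascAtMax i j)) n
      ≡⟨ binomialSum-cong n (λ i j _ → α-at-max i j) ⟩
    binomialSum (λ i j → α i * α j + (t - 1ℚ) * ((α i - δ₀ i) * δ₀ j)) n
      ≡⟨ binomialSum-+ n _ _ ⟩
    (α ⋆ α) n + binomialSum (λ i j → (t - 1ℚ) * ((α i - δ₀ i) * δ₀ j)) n
      ≡⟨ cong ((α ⋆ α) n +_) (binomialSum-*ˡ n (t - 1ℚ) _) ⟩
    (α ⋆ α) n + (t - 1ℚ) * ((λ i → α i - δ₀ i) ⋆ δ₀) n
      ≡⟨ cong (λ x → (α ⋆ α) n + (t - 1ℚ) * x) (⋆-identityʳ (λ i → α i - δ₀ i) n) ⟩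
    (α ⋆ α) n + (t - 1ℚ) * (α n - δ₀ n) ∎

  β-suc : ∀ n → β (suc n) ≡ (β ⋆ α) n + (t - 1ℚ) * β n
  β-suc n = begin
    β (suc n)
      ≡⟨ permWeight-suc {lrdasc′} {λ _ → lrdascAtMax} lrdasc′-++-max n ⟩
    binomialSum (λ i j → β i * (α j * t ^ℚ lrdascAtMax j)) n
      ≡⟨ binomialSum-cong n (λ i j _ → β-at-max i j) ⟩
    binomialSum (λ i j → β i * α j + (t - 1ℚ) * (β i * δ₀ j)) n
      ≡⟨ binomialSum-+ n _ _ ⟩
    (β ⋆ α) n + binomialSum (λ i j → (t - 1ℚ) * (β i * δ₀ j)) n
      ≡⟨ cong ((β ⋆ α) n +_) (binomialSum-*ˡ n (t - 1ℚ) _) ⟩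
    (β ⋆ α) n + (t - 1ℚ) * (β ⋆ δ₀) n
      ≡⟨ cong (λ x → (β ⋆ α) n + (t - 1ℚ) * x) (⋆-identityʳ β n) ⟩
    (β ⋆ α) n + (t - 1ℚ) * β n ∎

  egf≡egfOf-permWeight : ∀ {stat stat′} → (∀ π → stat π ≡ stat′ π) → ∀ n → egf stat t n ≡ egfOf (permWeight stat′) n
  egf≡egfOf-permWeight {stat} {stat′} stat≗stat′ n = cong (_* inv! n)
    (trans (sumOver-cong (perms n) (All.tabulate (λ {π} _ → cong (t ^ℚ_) (stat≗stat′ π))))
           (sumOver-↭ (λ π → t ^ℚ stat′ π) (perms↭arrangements n)))

theorem13 : (t : ℚ) →
    ((n : ℕ) → (egf rdasc t ⊛ den t) n ≡ num₁ t n) ×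
    ((n : ℕ) → (egf lrdasc t ⊛ den t) n ≡ num₂ t n)
theorem13 t = rdasc-identity , lrdasc-identity
  where
  open import Data.Product using (_,_)
  open import Data.Rational using (_*_)
  open import Relation.Binary.PropositionalEquality using (refl; cong; module ≡-Reasoning)
  open ≡-Reasoning
  open Convolution using (_⋆_; egfOf; egfOf-⋆; ⊛-cong)
  open Statistics using (rdasc≡rdasc′; lrdasc≡lrdasc′)
  open HyperbolicSeries t
  open Recurrences t

  rdasc-identity : ∀ n → (egf rdasc t ⊛ den t) n ≡ num₁ t n
  rdasc-identity n = begin
    (egf rdasc t ⊛ den t) n     ≡⟨ ⊛-cong (egf≡egfOf-permWeight rdasc≡rdasc′) den≡egfOf-denN n ⟩
    (egfOf α ⊛ egfOf denN) n    ≡⟨ egfOf-⋆ α denN n ⟩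
    egfOf (α ⋆ denN) n          ≡⟨ cong (_* inv! n) (α⋆denN≡num₁N α refl α-suc n) ⟩
    egfOf num₁N n               ≡⟨ num₁≡egfOf-num₁N n ⟨
    num₁ t n                    ∎

  lrdasc-identity : ∀ n → (egf lrdasc t ⊛ den t) n ≡ num₂ t n
  lrdasc-identity n = begin
    (egf lrdasc t ⊛ den t) n    ≡⟨ ⊛-cong (egf≡egfOf-permWeight lrdasc≡lrdasc′) den≡egfOf-denN n ⟩
    (egfOf β ⊛ egfOf denN) n    ≡⟨ egfOf-⋆ β denN n ⟩
    egfOf (β ⋆ denN) n          ≡⟨ cong (_* inv! n) (β⋆denN≡exp α refl α-suc β refl β-suc n) ⟩
    num₂ t n                    ∎
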